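{- Let $t\geq 5$ be an integer. For every canonical territory $(T,B)$, the graph $T$ is $C_{2t-2}$-free (it has no induced subgraph isomorphic to the cycle on $2t-2$ vertices).
   Context: Graphs are finite and simple. A path $P$ has length equal to its number of edges. A territory is a pair $(T,B)$ where $T$ is a graph and $B$ is an induced cycle in $T$; its perimeter is the length of $B$. Expansion (with respect to the fixed integer $t\geq 5$). Given a territory $(T',B')$, an expansion of it is any territory $(T,B)$ obtained as follows. Choose, for some integer $k\geq 0$, a stable set $\{x_1,\dots,x_k\}$ of vertices of $B'$, and for each $i$ let $x_i^-,x_i^+$ be the two neighbours of $x_i$ in $B'$. Choose $I\subseteq\{1,\dots,k\}$. Build $T$ from $T'$: for each $i$ add a new path $P_i$ of length $2t-6$ with ends $y_i^-,y_i^+$ and middle vertex $y_i$, and add edges $x_i^-y_i^-$, $x_iy_i$, $x_i^+y_i^+$; for each $i\in I$, with $v_i^-,v_i^+$ the neighbours of $y_i$ in $P_i$ ($v_i^-$ on the side of $y_i^-$), add a new path $Q_i$ of length $t-4$ with ends $z_i^-,z_i^+$ and edges $v_i^-z_i^-$, $v_i^+z_i^+$ (all added vertices new and distinct). For $i\notin I$ let $R_i=x_i^-\text{ - }y_i^-\text{ - }P_i\text{ - }y_i^+\text{ - }x_i^+$; for $i\in I$ let $R_i$ go $x_i^-,y_i^-$, along $P_i$ to $v_i^-$, then $z_i^-$, along $Q_i$ to $z_i^+$, then $v_i^+$, along $P_i$ to $y_i^+$, then $x_i^+$. Let $B=(B'\setminus\{x_1,\dots,x_k\})\cup R_1\cup\dots\cup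 R_k$ (an induced cycle of $T$). The territories $(T_m,B_m)$, $m\ge 0$: $T_0$ is a $t$-cycle and $B_0=T_0$. For $m\geq1$, with $N=t(t-3)^{m-1}$ and $B_{m-1}=x_1\text{ - }\cdots\text{ - }x_N\text{ - }x_1$, obtain $T_m$ from $T_{m-1}$ by adding a new cycle $B_m$ which is the $(t-4)$-subdivision of an $N$-cycle $x_1'\text{ - }\cdots\text{ - }x_N'\text{ - }x_1'$ (each edge replaced by a path of length $t-3$) and adding the edges $x_ix_i'$, $i=1,\dots,N$. A territory $(T,B)$ is canonical if for some $m\geq 0$ there is an expansion $(T',B')$ of $(T_m,B_m)$ and an isomorphism $f:V(T)\to V(T')$ between $T$ and $T'$ whose restriction to $V(B)$ is an isomorphism between $B$ and $B'$. -}

module Defs where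

open import Data.Nat using (ℕ; zero; suc; _+_; _*_; _∸_; _^_; _≤_)
open import Data.Fin using (Fin; toℕ)
open import Data.Bool using (Bool; true; false)
open import Data.Product using (Σ; _×_; _,_; proj₁)
open import Data.Sum using (_⊎_; inj₁; inj₂)
open import Data.Unit using (⊤)
open import Data.Empty using (⊥)
open import Relation.Nullary using (¬_)
open import Relation.Binary.PropositionalEquality using (_≡_; _≢_)
open import Function.Bundles using (_↔_; _⇔_; Inverse)
open import Data.Fin using (cast)
open import Data.Nat.Properties using (*-identityʳ)

CNext : (L : ℕ) → Fin L → Fin L → Set
CNext L a b = (suc (toℕ a) ≡ toℕ b) ⊎ (suc (toℕ a) ≡ L × toℕ b ≡ 0)

CycAdj : (L : ℕ) → Fin L → Fin L → Set
CycAdj L a b = CNext L a b ⊎ CNext L b a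

record FinGraph : Set₁ where
  field
    n      : ℕ
    adj    : Fin n → Fin n → Set
    sym    : ∀ {u v} → adj u v → adj v u
    irrefl : ∀ {u} → ¬ adj u u
open FinGraph public

IsInducedCycle : (G : FinGraph) → (Fin (n G) → Bool) → Set
IsInducedCycle G B =
  Σ ℕ λ L → (3 ≤ L) × Σ (Fin L ↔ Σ (Fin (n G)) (λ v → B v ≡ true)) λ g →
    ∀ p q → adj G (proj₁ (Inverse.to g p)) (proj₁ (Inverse.to g q)) ⇔ CycAdj L p q

record Territory : Set₁ where
  field
    T       : FinGraph
    B       : Fin (n T) → Bool
    induced : IsInducedCycle T B
open Territory public

CycleFree : ℕ → FinGraph → Set
CycleFree L G =
  ¬ (Σ (Fin L → Fin (n G)) λ h →
       (∀ p q → h p ≡ h q → p ≡ q) ×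
       (∀ p q → adj G (h p) (h q) ⇔ CycAdj L p q))

-- Raw territories (arbitrary vertex type), used for the constructions

record RawTerr : Set₁ where
  field
    V : Set
    E : V → V → Set
    Bd : V → Set
open RawTerr public

module _ (t : ℕ) where

  len : ℕ → ℕ
  len m = t * (t ∸ 3) ^ m

  -- V(T_m) = V(T_{m-1}) ⊎ V(B_m), with V(B_m) = positions on the new cycle
  TmV : ℕ → Set
  TmV zero    = Fin t
  TmV (suc m) = TmV m ⊎ Fin (len (suc m))

  enum : (m : ℕ) → Fin (len m) → TmV m
  enum zero    p = cast (*-identityʳ t) p
  enum (suc m) p = inj₂ p

  -- directed description of the edges of T_m (symmetrised below)
  TmD : (m : ℕ) → TmV m → TmV m → Set
  TmD zero    a b = CycAdj t a b
  TmD (suc m) (inj₁ a) (inj₁ b) = TmD m a b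
  TmD (suc m) (inj₂ p) (inj₂ q) = CycAdj (len (suc m)) p q
  -- x_i x_i' where x_i' is at position i(t-3) on the subdivided N-cycle
  TmD (suc m) (inj₁ a) (inj₂ p) =
    Σ (Fin (len m)) λ i → (a ≡ enum m i) × (toℕ p ≡ toℕ i * (t ∸ 3))
  TmD (suc m) (inj₂ _) (inj₁ _) = ⊥

  TmB : (m : ℕ) → TmV m → Set
  TmB zero    _        = ⊤
  TmB (suc m) (inj₁ _) = ⊥
  TmB (suc m) (inj₂ _) = ⊤

  Tm : ℕ → RawTerr
  Tm m = record { V = TmV m ; E = λ a b → TmD m a b ⊎ TmD m b a ; Bd = TmB m }

  record ExpData (R : RawTerr) : Set where
    field
      k   : ℕ
      x   : Fin k → V R
      xm  : Fin k → V R
      xp  : Fin k → V R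
      I   : Fin k → Bool
      x∈B  : ∀ i → Bd R (x i)
      xm∈B : ∀ i → Bd R (xm i)
      xp∈B : ∀ i → Bd R (xp i)
      xm~x : ∀ i → E R (xm i) (x i)
      xp~x : ∀ i → E R (xp i) (x i)
      xm≢xp : ∀ i → xm i ≢ xp i
      x-inj    : ∀ i j → x i ≡ x j → i ≡ j
      x-stable : ∀ i j → ¬ E R (x i) (x j)

  module _ (R : RawTerr) (d : ExpData R) where
    open ExpData d

    -- P_i has vertices 0..2t-6 (0 = y_i^-, t-3 = y_i, 2t-6 = y_i^+);
    -- Q_i has vertices 0..t-4 (0 = z_i^-, t-4 = z_i^+).
    ExpV : Set
    ExpV = V R ⊎ ((Fin k × Fin (2 * t ∸ 5)) ⊎ (Σ (Fin k) (λ i → I i ≡ true) × Fin (t ∸ 3)))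

    ExpD : ExpV → ExpV → Set
    ExpD (inj₁ a) (inj₁ b) = E R a b
    ExpD (inj₂ (inj₁ (i , j))) (inj₂ (inj₁ (i' , j'))) =
      (i ≡ i') × (toℕ j' ≡ suc (toℕ j))
    ExpD (inj₂ (inj₂ ((i , _) , j))) (inj₂ (inj₂ ((i' , _) , j'))) =
      (i ≡ i') × (toℕ j' ≡ suc (toℕ j))
    ExpD (inj₁ a) (inj₂ (inj₁ (i , j))) =
      ((a ≡ xm i) × (toℕ j ≡ 0)) ⊎
      ((a ≡ x i) × (toℕ j ≡ t ∸ 3)) ⊎
      ((a ≡ xp i) × (toℕ j ≡ 2 * t ∸ 6))
    ExpD (inj₂ (inj₁ (i , j))) (inj₂ (inj₂ ((i' , _) , j'))) =
      (i ≡ i') ×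
      (((toℕ j ≡ t ∸ 4) × (toℕ j' ≡ 0)) ⊎ ((toℕ j ≡ t ∸ 2) × (toℕ j' ≡ t ∸ 4)))
    ExpD _ _ = ⊥

    ExpB : ExpV → Set
    ExpB (inj₁ a) = Bd R a × (∀ i → a ≢ x i)
    ExpB (inj₂ (inj₁ (i , j))) = ¬ ((I i ≡ true) × (toℕ j ≡ t ∸ 3))
    ExpB (inj₂ (inj₂ _)) = ⊤

    Expand : RawTerr
    Expand = record { V = ExpV ; E = λ a b → ExpD a b ⊎ ExpD b a ; Bd = ExpB }

  IsoTerr : Territory → RawTerr → Set
  IsoTerr Tr R =
    Σ (Fin (n (T Tr)) ↔ V R) λ f →
      (∀ a b → adj (T Tr) a b ⇔ E R (Inverse.to f a) (Inverse.to f b)) ×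
      (∀ a → (B Tr a ≡ true) ⇔ Bd R (Inverse.to f a))

  Canonical : Territory → Set
  Canonical Tr = Σ ℕ λ m → Σ (ExpData (Tm m)) λ d → IsoTerr Tr (Expand (Tm m) d)

-- Write s = t - 3 and L = 2t - 2 = 2s + 4. An induced L-cycle C in T_m is impossible by induction on m:
-- T_0 has t < L vertices; in T_(m+1), C cannot run around all of B_(m+1), which is longer than L, and if it
-- passes from x_a onto B_(m+1) it is forced along the stretch of length 2s from x'_a to x'_(a±2), after
-- which the two remaining steps cannot close it up without a chord. In an expansion the paths P_i behave
-- like such stretches, entered from x_i^-, x_i or x_i^+; entering Q_i forces C through Q_i and along P_i
-- to x_i^+, from where two steps do not lead back. Finally C cannot lie inside the paths P_i or Q_i.

module Submission where

open import Axiom.UniquenessOfIdentityProofs using (module Decidable⇒UIP)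
open import Data.Bool using (true)
import Data.Bool.Properties as Bool
open import Data.Empty using (⊥; ⊥-elim)
open import Data.Fin using (Fin; toℕ; fromℕ<; cast)
open import Data.Fin.Properties using (toℕ-injective; toℕ<n; toℕ-fromℕ<; toℕ-cast; any?; pigeonhole)
open import Data.List using (allFin)
open import Data.List.Extrema.Nat using (argmax; f[xs]≤f[argmax])
open import Data.List.Membership.Propositional.Properties using (∈-allFin)
import Data.List.Relation.Unary.All as All
open import Data.Nat using (ℕ; zero; suc; _+_; _*_; _∸_; _^_; _≤_; _<_; z≤n; s≤s; z<s; s<s; NonZero; >-nonZero; _%_; pred; _<?_)
open import Data.Nat.Divisibility using (divides)
open import Data.Nat.DivMod
open import Data.Nat.Properties
open import Data.Nat.Tactic.RingSolver using (solve-∀)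
open import Data.Product using (Σ; _×_; _,_; proj₁; proj₂)
open import Data.Sum as Sum using (_⊎_; inj₁; inj₂)
open import Data.Sum.Properties using (inj₁-injective; inj₂-injective)
open import Data.Unit using (⊤; tt)
open import Function.Base using (_∘_)
open import Function.Bundles using (_⇔_; _↔_; Equivalence; Inverse; mk⇔)
import Function.Properties.Equivalence as ⇔
open import Relation.Binary.Definitions using (tri<; tri≈; tri>)
open import Relation.Binary.PropositionalEquality
open import Relation.Nullary using (¬_; Dec; yes; no; ¬?)
open import Defs hiding (sym)

-- Arithmetic modulo n

gap⇒< : ∀ a b d → suc a + d ≡ b → a < b
gap⇒< a b d refl = m≤m+n (suc a) d

[m%n+k]%n≡[m+k]%n : ∀ m k n .{{_ : NonZero n}} → (m % n + k) % n ≡ (m + k) % n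
[m%n+k]%n≡[m+k]%n m k n = begin
  (m % n + k) % n          ≡⟨ %-distribˡ-+ (m % n) k n ⟩
  (m % n % n + k % n) % n  ≡⟨ cong (λ x → (x + k % n) % n) (m%n%n≡m%n m n) ⟩
  (m % n + k % n) % n      ≡⟨ %-distribˡ-+ m k n ⟨
  (m + k) % n              ∎
  where open ≡-Reasoning

[m+k]%n≢m%n : ∀ m {k n} .{{_ : NonZero n}} → 0 < k → k < n → (m + k) % n ≢ m % n
[m+k]%n≢m%n m {k} {n} 0<k k<n eq with m % n + k <? n
... | yes x+k<n = <⇒≢ 0<k (sym (+-cancelˡ-≡ (m % n) k 0 (begin
  m % n + k          ≡⟨ m<n⇒m%n≡m x+k<n ⟨
  (m % n + k) % n    ≡⟨ [m%n+k]%n≡[m+k]%n m k n ⟩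
  (m + k) % n        ≡⟨ eq ⟩
  m % n              ≡⟨ +-identityʳ (m % n) ⟨
  m % n + 0          ∎)))
  where open ≡-Reasoning
... | no x+k≮n = <⇒≢ k<n (+-cancelˡ-≡ (m % n) k n (begin
  m % n + k              ≡⟨ m∸n+n≡m n≤x+k ⟨
  m % n + k ∸ n + n      ≡⟨ cong (_+ n) wrapped ⟩
  m % n + n              ∎))
  where
  open ≡-Reasoning
  n≤x+k : n ≤ m % n + k
  n≤x+k = ≮⇒≥ x+k≮n
  x+k∸n<n : m % n + k ∸ n < n
  x+k∸n<n = +-cancelʳ-< _ _ n (subst (_< n + n) (sym (m∸n+n≡m n≤x+k)) (+-mono-< (m%n<n m n) k<n))
  wrapped : m % n + k ∸ n ≡ m % n
  wrapped = begin
    m % n + k ∸ n          ≡⟨ m<n⇒m%n≡m x+k∸n<n ⟨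
    (m % n + k ∸ n) % n    ≡⟨ m≤n⇒[n∸m]%m≡n%m n≤x+k ⟩
    (m % n + k) % n        ≡⟨ [m%n+k]%n≡[m+k]%n m k n ⟩
    (m + k) % n            ≡⟨ eq ⟩
    m % n                  ∎

[p+a]%n≢[p+b]%n : ∀ p {a b n} .{{_ : NonZero n}} → a < b → b < a + n → (p + a) % n ≢ (p + b) % n
[p+a]%n≢[p+b]%n p {a} {b} {n} a<b b<a+n eq =
  [m+k]%n≢m%n (p + a) (m<n⇒0<n∸m a<b) (+-cancelˡ-< a _ n (subst (_< a + n) (sym a+[b∸a]≡b) b<a+n)) (begin
    (p + a + (b ∸ a)) % n  ≡⟨ cong (_% n) (trans (+-assoc p a (b ∸ a)) (cong (p +_) a+[b∸a]≡b)) ⟩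
    (p + b) % n            ≡⟨ eq ⟨
    (p + a) % n            ∎)
  where
  open ≡-Reasoning
  a+[b∸a]≡b : a + (b ∸ a) ≡ b
  a+[b∸a]≡b = m+[n∸m]≡n (<⇒≤ a<b)

[p+a]%n≡[p+b]%n⇒a≡b : ∀ p {a b n} .{{_ : NonZero n}} → a < n → b < n → (p + a) % n ≡ (p + b) % n → a ≡ b
[p+a]%n≡[p+b]%n⇒a≡b p {a} {b} {n} a<n b<n eq with <-cmp a b
... | tri≈ _ a≡b _ = a≡b
... | tri< a<b _ _ = ⊥-elim ([p+a]%n≢[p+b]%n p a<b (≤-trans b<n (m≤n+m n a)) eq)
... | tri> _ _ b<a = ⊥-elim ([p+a]%n≢[p+b]%n p b<a (≤-trans a<n (m≤n+m n b)) (sym eq))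

-- The cyclic order on Fin L

CNext⇒suc%≡ : ∀ L .{{_ : NonZero L}} {a b : Fin L} → CNext L a b → suc (toℕ a) % L ≡ toℕ b
CNext⇒suc%≡ L {b = b} (inj₁ e) = trans (cong (_% L) e) (m<n⇒m%n≡m (toℕ<n b))
CNext⇒suc%≡ L (inj₂ (e₁ , e₂)) = trans (cong (_% L) e₁) (trans (n%n≡0 L) (sym e₂))

suc%≡⇒CNext : ∀ L .{{_ : NonZero L}} {a b : Fin L} → suc (toℕ a) % L ≡ toℕ b → CNext L a b
suc%≡⇒CNext L {a} e with m≤n⇒m<n∨m≡n (toℕ<n a)
... | inj₁ a+1<L = inj₁ (trans (sym (m<n⇒m%n≡m a+1<L)) e)
... | inj₂ a+1≡L = inj₂ (a+1≡L , trans (sym e) (trans (cong (_% L) a+1≡L) (n%n≡0 L)))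

CycAdj-sym : ∀ {L} {a b : Fin L} → CycAdj L a b → CycAdj L b a
CycAdj-sym (inj₁ ab) = inj₂ ab
CycAdj-sym (inj₂ ba) = inj₁ ba

CycAdj-cast : ∀ {L L'} → L ≡ L' → {x y : Fin L} {x' y' : Fin L'} →
              toℕ x ≡ toℕ x' → toℕ y ≡ toℕ y' → CycAdj L x y → CycAdj L' x' y'
CycAdj-cast refl ex ey = Sum.map (CNext-cast ex ey) (CNext-cast ey ex)
  where
  CNext-cast : ∀ {L} {x y x' y' : Fin L} → toℕ x ≡ toℕ x' → toℕ y ≡ toℕ y' → CNext _ x y → CNext _ x' y'
  CNext-cast ex ey (inj₁ e) = inj₁ (trans (cong suc (sym ex)) (trans e ey))
  CNext-cast ex ey (inj₂ (e₁ , e₂)) = inj₂ (trans (cong suc (sym ex)) e₁ , trans (sym ey) e₂)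

module CyclicOrder (L : ℕ) .{{_ : NonZero L}} (L≥5 : 5 ≤ L) where

  Ahead : ℕ → Fin L → Fin L → Set
  Ahead k x y = toℕ y ≡ (toℕ x + k) % L

  CycAdj⇒Ahead : ∀ {x y} → CycAdj L x y → Ahead 1 x y ⊎ Ahead 1 y x
  CycAdj⇒Ahead {x} (inj₁ e) = inj₁ (trans (sym (CNext⇒suc%≡ L e)) (cong (_% L) (+-comm 1 (toℕ x))))
  CycAdj⇒Ahead {y = y} (inj₂ e) = inj₂ (trans (sym (CNext⇒suc%≡ L e)) (cong (_% L) (+-comm 1 (toℕ y))))

  Ahead⇒CycAdj : ∀ {x y} → Ahead 1 x y → CycAdj L x y
  Ahead⇒CycAdj {x} e = inj₁ (suc%≡⇒CNext L (trans (cong (_% L) (+-comm 1 (toℕ x))) (sym e)))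

  Ahead-trans : ∀ k k' {x y z} → Ahead k x y → Ahead k' y z → Ahead (k + k') x z
  Ahead-trans k k' {x} e₁ e₂ = trans e₂ (trans (cong (λ v → (v + k') % L) e₁)
    (trans ([m%n+k]%n≡[m+k]%n (toℕ x + k) k' L) (cong (_% L) (+-assoc (toℕ x) k k'))))

  Ahead-irrefl : ∀ k {x} → 0 < k → k < L → ¬ Ahead k x x
  Ahead-irrefl k {x} 0<k k<L e = [p+a]%n≢[p+b]%n (toℕ x) 0<k k<L
    (trans (cong (_% L) (+-identityʳ (toℕ x))) (trans (m<n⇒m%n≡m (toℕ<n x)) e))

  Ahead-functional : ∀ k {x y z} → Ahead k x y → Ahead k x z → y ≡ z
  Ahead-functional k e₁ e₂ = toℕ-injective (trans e₁ (sym e₂))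

  Ahead-injective : ∀ {x y z} → Ahead 1 x z → Ahead 1 y z → x ≡ y
  Ahead-injective {x} {y} e₁ e₂ = toℕ-injective ([p+a]%n≡[p+b]%n⇒a≡b 1 (toℕ<n x) (toℕ<n y)
    (trans (cong (_% L) (+-comm 1 (toℕ x))) (trans (sym e₁) (trans e₂ (cong (_% L) (+-comm (toℕ y) 1))))))

  private
    1<L : 1 < L
    1<L = ≤-trans (s≤s (s≤s z≤n)) L≥5
    3<L : 3 < L
    3<L = ≤-trans (s≤s (s≤s (s≤s (s≤s z≤n)))) L≥5

  CycAdj-common-neighbour : ∀ {a b c d} → CycAdj L b a → CycAdj L b c → a ≢ c →
                            CycAdj L a d → CycAdj L c d → d ≡ b
  CycAdj-common-neighbour {a} {b} {c} {d} ba bc a≢c ad cd =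
    go (CycAdj⇒Ahead ba) (CycAdj⇒Ahead bc) (CycAdj⇒Ahead ad) (CycAdj⇒Ahead cd)
    where
    go : Ahead 1 b a ⊎ Ahead 1 a b → Ahead 1 b c ⊎ Ahead 1 c b →
         Ahead 1 a d ⊎ Ahead 1 d a → Ahead 1 c d ⊎ Ahead 1 d c → d ≡ b
    go (inj₁ x) (inj₁ y) _ _ = ⊥-elim (a≢c (Ahead-functional 1 x y))
    go (inj₂ x) (inj₂ y) _ _ = ⊥-elim (a≢c (Ahead-injective x y))
    go _ _ (inj₁ x) (inj₁ y) = ⊥-elim (a≢c (Ahead-injective x y))
    go _ _ (inj₂ x) (inj₂ y) = ⊥-elim (a≢c (Ahead-functional 1 x y))
    go (inj₁ x) (inj₂ y) (inj₁ u) (inj₂ v) =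
      ⊥-elim (Ahead-irrefl 4 (s≤s z≤n) L≥5 (Ahead-trans 3 1 (Ahead-trans 2 1 (Ahead-trans 1 1 x u) v) y))
    go (inj₁ x) (inj₂ y) (inj₂ u) (inj₁ v) = Ahead-injective u x
    go (inj₂ x) (inj₁ y) (inj₁ u) (inj₂ v) = Ahead-functional 1 u x
    go (inj₂ x) (inj₁ y) (inj₂ u) (inj₁ v) =
      ⊥-elim (Ahead-irrefl 4 (s≤s z≤n) L≥5 (Ahead-trans 3 1 (Ahead-trans 2 1 (Ahead-trans 1 1 y v) u) x))

  CycAdj-triangle-free : ∀ {a b c} → CycAdj L b a → CycAdj L b c → a ≢ c → ¬ CycAdj L a c
  CycAdj-triangle-free {a} {b} {c} ba bc a≢c ac = go (CycAdj⇒Ahead ba) (CycAdj⇒Ahead bc) (CycAdj⇒Ahead ac)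
    where
    go : Ahead 1 b a ⊎ Ahead 1 a b → Ahead 1 b c ⊎ Ahead 1 c b → Ahead 1 a c ⊎ Ahead 1 c a → ⊥
    go (inj₁ x) (inj₁ y) _ = a≢c (Ahead-functional 1 x y)
    go (inj₂ x) (inj₂ y) _ = a≢c (Ahead-injective x y)
    go (inj₁ x) (inj₂ y) (inj₁ u) = Ahead-irrefl 3 (s≤s z≤n) 3<L (Ahead-trans 2 1 (Ahead-trans 1 1 x u) y)
    go (inj₁ x) (inj₂ y) (inj₂ u) = Ahead-irrefl 1 (s≤s z≤n) 1<L (subst (λ z → Ahead 1 z b) (Ahead-injective u x) y)
    go (inj₂ x) (inj₁ y) (inj₁ u) = Ahead-irrefl 1 (s≤s z≤n) 1<L (subst (Ahead 1 b) (Ahead-functional 1 u x) y)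
    go (inj₂ x) (inj₁ y) (inj₂ u) = Ahead-irrefl 3 (s≤s z≤n) 3<L (Ahead-trans 2 1 (Ahead-trans 1 1 y u) x)

IsLeft IsRight : ∀ {A B : Set} → A ⊎ B → Set
IsLeft = Sum.[ (λ _ → ⊤) , (λ _ → ⊥) ]
IsRight = Sum.[ (λ _ → ⊥) , (λ _ → ⊤) ]

isLeft? : ∀ {A B : Set} (v : A ⊎ B) → Dec (IsLeft v)
isLeft? (inj₁ _) = yes tt
isLeft? (inj₂ _) = no λ ()

isRight? : ∀ {A B : Set} (v : A ⊎ B) → Dec (IsRight v)
isRight? (inj₁ _) = no λ ()
isRight? (inj₂ _) = yes tt

fromLeft : ∀ {A B : Set} (v : A ⊎ B) → ¬ IsRight v → Σ A λ a → v ≡ inj₁ a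
fromLeft (inj₁ a) _ = a , refl
fromLeft (inj₂ _) ¬right = ⊥-elim (¬right tt)

fromRight : ∀ {A B : Set} (v : A ⊎ B) → ¬ IsLeft v → Σ B λ b → v ≡ inj₂ b
fromRight (inj₁ _) ¬left = ⊥-elim (¬left tt)
fromRight (inj₂ b) _ = b , refl

IsLeft⇒¬IsRight : ∀ {A B : Set} (v : A ⊎ B) → IsLeft v → ¬ IsRight v
IsLeft⇒¬IsRight (inj₁ _) _ ()

-- Induced cycles

record InducedCycle {V : Set} (E : V → V → Set) (L : ℕ) : Set where
  field
    vertex           : Fin L → V
    vertex-injective : ∀ p q → vertex p ≡ vertex q → p ≡ q
    edge⇔CycAdj      : ∀ p q → E (vertex p) (vertex q) ⇔ CycAdj L p q

pullback : ∀ {V W : Set} {E : V → V → Set} {E' : W → W → Set} {L} (cy : InducedCycle E L) (f : W → V) →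
           (∀ x y → E (f x) (f y) → E' x y) → (∀ x y → E' x y → E (f x) (f y)) →
           (c : Fin L → W) → (∀ q → InducedCycle.vertex cy q ≡ f (c q)) → InducedCycle E' L
pullback {E = E} cy f reflect preserve c c-lift = record
  { vertex           = c
  ; vertex-injective = λ p q e → vertex-injective p q (trans (c-lift p) (trans (cong f e) (sym (c-lift q))))
  ; edge⇔CycAdj      = λ p q → mk⇔
      (λ h → Equivalence.to (edge⇔CycAdj p q) (subst₂ E (sym (c-lift p)) (sym (c-lift q)) (preserve _ _ h)))
      (λ h → reflect _ _ (subst₂ E (c-lift p) (c-lift q) (Equivalence.from (edge⇔CycAdj p q) h)))
  }
  where open InducedCycle cy

induced-cycle-image : ∀ {G : FinGraph} {V : Set} {E : V → V → Set} {L} (f : Fin (n G) ↔ V) →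
  (∀ a b → adj G a b ⇔ E (Inverse.to f a) (Inverse.to f b)) →
  (h : Fin L → Fin (n G)) → (∀ p q → h p ≡ h q → p ≡ q) → (∀ p q → adj G (h p) (h q) ⇔ CycAdj L p q) →
  InducedCycle E L
induced-cycle-image f f-adj h h-injective h-adj = record
  { vertex           = Inverse.to f ∘ h
  ; vertex-injective = λ p q e → h-injective p q
      (trans (sym (Inverse.strictlyInverseʳ f (h p))) (trans (cong (Inverse.from f) e) (Inverse.strictlyInverseʳ f (h q))))
  ; edge⇔CycAdj      = λ p q → ⇔.trans (⇔.sym (f-adj (h p) (h q))) (h-adj p q)
  }

module OnCycle {V : Set} {E : V → V → Set} {L : ℕ} .{{_ : NonZero L}} (L≥3 : 3 ≤ L)
               (cy : InducedCycle E L) where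
  open InducedCycle cy

  idx : ℕ → Fin L
  idx i = fromℕ< (m%n<n i L)

  toℕ-idx : ∀ i → toℕ (idx i) ≡ i % L
  toℕ-idx i = toℕ-fromℕ< (m%n<n i L)

  C : ℕ → V
  C i = vertex (idx i)

  C-toℕ : ∀ q → C (toℕ q) ≡ vertex q
  C-toℕ q = cong vertex (toℕ-injective (trans (toℕ-idx (toℕ q)) (m<n⇒m%n≡m (toℕ<n q))))

  C-%-injective : ∀ i j → C i ≡ C j → i % L ≡ j % L
  C-%-injective i j e = trans (sym (toℕ-idx i)) (trans (cong toℕ (vertex-injective _ _ e)) (toℕ-idx j))

  C-periodic : ∀ i → C (L + i) ≡ C i
  C-periodic i = cong vertex (toℕ-injective (begin
    toℕ (idx (L + i))  ≡⟨ toℕ-idx (L + i) ⟩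
    (L + i) % L        ≡⟨ cong (_% L) (+-comm L i) ⟩
    (i + L) % L        ≡⟨ [m+n]%n≡m%n i L ⟩
    i % L              ≡⟨ toℕ-idx i ⟨
    toℕ (idx i)        ∎))
    where open ≡-Reasoning

  suc-idx : ∀ i → suc (toℕ (idx i)) % L ≡ toℕ (idx (suc i))
  suc-idx i = begin
    suc (toℕ (idx i)) % L  ≡⟨ cong (λ z → suc z % L) (toℕ-idx i) ⟩
    (1 + i % L) % L        ≡⟨ cong (_% L) (+-comm 1 (i % L)) ⟩
    (i % L + 1) % L        ≡⟨ [m%n+k]%n≡[m+k]%n i 1 L ⟩
    (i + 1) % L            ≡⟨ cong (_% L) (+-comm i 1) ⟩
    suc i % L              ≡⟨ toℕ-idx (suc i) ⟨
    toℕ (idx (suc i))      ∎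
    where open ≡-Reasoning

  C-edge : ∀ i → E (C i) (C (suc i))
  C-edge i = Equivalence.from (edge⇔CycAdj (idx i) (idx (suc i))) (inj₁ (suc%≡⇒CNext L (suc-idx i)))

  C-edge-sym : ∀ i j → E (C i) (C j) → E (C j) (C i)
  C-edge-sym i j h = Equivalence.from (edge⇔CycAdj (idx j) (idx i)) (CycAdj-sym (Equivalence.to (edge⇔CycAdj (idx i) (idx j)) h))

  C-edge⇒consecutive : ∀ i j → E (C i) (C j) → (suc i % L ≡ j % L) ⊎ (suc j % L ≡ i % L)
  C-edge⇒consecutive i j h = Sum.map (next i j) (next j i) (Equivalence.to (edge⇔CycAdj (idx i) (idx j)) h)
    where
    next : ∀ i j → CNext L (idx i) (idx j) → suc i % L ≡ j % L
    next i j ij = trans (cong (_% L) (+-comm 1 i)) (trans (sym ([m%n+k]%n≡[m+k]%n i 1 L))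
      (trans (cong (λ z → (z + 1) % L) (sym (toℕ-idx i))) (trans (cong (_% L) (+-comm (toℕ (idx i)) 1))
      (trans (CNext⇒suc%≡ L ij) (toℕ-idx j)))))

  C-distinct : ∀ p a b → a < b → b < a + L → C (p + a) ≢ C (p + b)
  C-distinct p a b a<b b<a+L e = [p+a]%n≢[p+b]%n p a<b b<a+L (C-%-injective _ _ e)

  C-no-chord : ∀ p a b → suc a < b → suc b < a + L → ¬ E (C (p + a)) (C (p + b))
  C-no-chord p a b a+1<b b+1<a+L e with C-edge⇒consecutive (p + a) (p + b) e
  ... | inj₁ x = [p+a]%n≢[p+b]%n p a+1<b (m<n⇒m<1+n (<-trans (n<1+n b) b+1<a+L)) (trans (cong (_% L) (+-suc p a)) x)
  ... | inj₂ y = [p+a]%n≢[p+b]%n p (<-trans (<-trans (n<1+n a) a+1<b) (n<1+n b)) b+1<a+L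
                   (sym (trans (cong (_% L) (+-suc p b)) y))

  C-no-repeat₂ : ∀ p → C p ≢ C (suc (suc p))
  C-no-repeat₂ p e = C-distinct p 0 2 (s≤s z≤n) (≤-trans L≥3 (m≤n+m L 0))
    (trans (cong C (+-identityʳ p)) (trans e (cong C (+-comm 2 p))))

  C-argmax : (f : V → ℕ) → Σ ℕ λ q → ∀ k → f (C k) ≤ f (C q)
  C-argmax f = toℕ q , λ k → subst (λ v → f (C k) ≤ f v) (sym (C-toℕ q))
                                   (All.lookup (f[xs]≤f[argmax] {f = f ∘ vertex} (idx 0) (allFin L)) (∈-allFin (idx k)))
    where q = argmax (f ∘ vertex) (idx 0) (allFin L)

  entry-point : (P : V → Set) → (∀ v → Dec (P v)) → ∀ q₀ q₁ → P (vertex q₀) → ¬ P (vertex q₁) →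
                Σ ℕ λ p → ¬ P (C p) × P (C (suc p))
  entry-point P P? q₀ q₁ Pq₀ ¬Pq₁ =
    search (toℕ q₀ + L ∸ toℕ q₁) (¬Pq₁ ∘ subst P (C-toℕ q₁)) (subst P (sym q₀-again) Pq₀)
    where
    q₀-again : C (toℕ q₁ + (toℕ q₀ + L ∸ toℕ q₁)) ≡ vertex q₀
    q₀-again = trans (cong C (trans (m+[n∸m]≡n (≤-trans (<⇒≤ (toℕ<n q₁)) (m≤n+m L (toℕ q₀)))) (+-comm (toℕ q₀) L)))
                     (trans (C-periodic (toℕ q₀)) (C-toℕ q₀))
    search : ∀ k → ¬ P (C (toℕ q₁)) → P (C (toℕ q₁ + k)) → Σ ℕ λ p → ¬ P (C p) × P (C (suc p))
    search zero ¬P₁ P₁ = ⊥-elim (¬P₁ (subst P (cong C (+-identityʳ (toℕ q₁))) P₁))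
    search (suc k) ¬P₁ Pk+1 with P? (C (toℕ q₁ + k))
    ... | yes Pk = search k ¬P₁ Pk
    ... | no ¬Pk = toℕ q₁ + k , ¬Pk , subst P (cong C (+-suc (toℕ q₁) k)) Pk+1

  InteriorConfined : (w : ℕ → V) (K : ℕ) → Set
  InteriorConfined w K = ∀ j k → 0 < j → j < K → E (w j) (C k) → C k ≡ w (pred j) ⊎ C k ≡ w (suc j)

  follow-path : (w : ℕ → V) (i K : ℕ) → InteriorConfined w K →
                C i ≡ w 0 → C (suc i) ≡ w 1 → ∀ j → j ≤ K → C (i + j) ≡ w j
  follow-path w i K confined C₀ C₁ zero _ = trans (cong C (+-identityʳ i)) C₀
  follow-path w i K confined C₀ C₁ (suc zero) _ = trans (cong C (+-comm i 1)) C₁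
  follow-path w i K confined C₀ C₁ (suc (suc j)) j+2≤K = extend
    (follow-path w i K confined C₀ C₁ j (≤-trans (n≤1+n j) (≤-trans (n≤1+n (suc j)) j+2≤K)))
    (follow-path w i K confined C₀ C₁ (suc j) (≤-trans (n≤1+n (suc j)) j+2≤K))
    where
    extend : C (i + j) ≡ w j → C (i + suc j) ≡ w (suc j) → C (i + suc (suc j)) ≡ w (suc (suc j))
    extend Cj Cj+1 with confined (suc j) (i + suc (suc j)) (s≤s z≤n) j+2≤K
                          (subst (λ z → E z (C (i + suc (suc j)))) Cj+1
                                 (subst (E (C (i + suc j)) ∘ C) (sym (+-suc i (suc j))) (C-edge (i + suc j))))
    ... | inj₂ e = e
    ... | inj₁ e = ⊥-elim (C-distinct i j (suc (suc j)) (<-trans (n<1+n j) (n<1+n (suc j)))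
                     (subst (3 + j ≤_) (+-comm L j) (+-monoˡ-≤ j L≥3)) (trans Cj (sym e)))

  -- Both cycle neighbours of a highest vertex would be lower neighbours.
  no-path-coordinate : (f : V → ℕ) →
    (∀ i → f (C (suc i)) ≡ suc (f (C i)) ⊎ f (C i) ≡ suc (f (C (suc i)))) →
    (∀ a b q → E (C q) (C a) → E (C q) (C b) → suc (f (C a)) ≡ f (C q) → suc (f (C b)) ≡ f (C q) → C a ≡ C b) → ⊥
  no-path-coordinate f moves lower-unique with C-argmax f
  ... | q , max = top (moves q) (moves (L ∸ 1 + q))
    where
    L∸1+1 : L ∸ 1 + 1 ≡ L
    L∸1+1 = m∸n+n≡m (≤-trans (s≤s z≤n) L≥3)
    before : C (suc (L ∸ 1 + q)) ≡ C q
    before = trans (cong C (trans (sym (+-suc (L ∸ 1) q)) (trans (sym (+-assoc (L ∸ 1) 1 q)) (cong (_+ q) L∸1+1)))) (C-periodic q)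
    top : _ → _ → ⊥
    top (inj₁ up) _ = <-irrefl refl (≤-trans (≤-reflexive (sym up)) (max (suc q)))
    top (inj₂ _) (inj₂ up) = <-irrefl refl (≤-trans (≤-reflexive (trans (sym (cong (suc ∘ f) before)) (sym up))) (max (L ∸ 1 + q)))
    top (inj₂ down₁) (inj₁ down₂) = C-distinct q 1 (L ∸ 1) (∸-monoˡ-≤ 1 L≥3) (s≤s (m∸n≤m L 1))
      (trans (cong C (+-comm q 1)) (trans same (cong C (+-comm (L ∸ 1) q))))
      where
      same : C (suc q) ≡ C (L ∸ 1 + q)
      same = lower-unique (suc q) (L ∸ 1 + q) q (C-edge q)
               (C-edge-sym (L ∸ 1 + q) q (subst (E (C (L ∸ 1 + q))) before (C-edge (L ∸ 1 + q))))
               (sym down₁) (trans (sym down₂) (cong f before))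

  no-cycle-along-paths : {I : Set} (at : I → ℕ → V) (height : V → ℕ) →
    (∀ q → Σ I λ i → Σ ℕ λ j → C q ≡ at i j × height (at i j) ≡ j) →
    (∀ q k {i j} → C q ≡ at i j → height (at i j) ≡ j → E (C q) (C k) →
       (C k ≡ at i (suc j) × height (at i (suc j)) ≡ suc j) ⊎
       (Σ ℕ λ j' → j ≡ suc j' × C k ≡ at i j' × height (at i j') ≡ j')) → ⊥
  no-cycle-along-paths at height located along = no-path-coordinate height moves lower-unique
    where
    moves : ∀ q → height (C (suc q)) ≡ suc (height (C q)) ⊎ height (C q) ≡ suc (height (C (suc q)))
    moves q with located q
    ... | i , j , Cq , h with along q (suc q) Cq h (C-edge q)
    ...   | inj₁ (Cq+1 , h') = inj₁ (trans (cong height Cq+1) (trans h' (cong suc (sym (trans (cong height Cq) h)))))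
    ...   | inj₂ (j' , j≡1+j' , Cq+1 , h') =
            inj₂ (trans (cong height Cq) (trans h (trans j≡1+j' (cong suc (sym (trans (cong height Cq+1) h'))))))
    lower : ∀ a q {i j} → C q ≡ at i j → height (at i j) ≡ j → E (C q) (C a) → suc (height (C a)) ≡ height (C q) →
            Σ ℕ λ j' → j ≡ suc j' × C a ≡ at i j'
    lower a q Cq h e lower-a with along q a Cq h e
    ... | inj₁ (Ca , h') = ⊥-elim (>⇒≢ (m<n⇒m<1+n (n<1+n _))
                                      (trans (cong suc (sym (trans (cong height Ca) h'))) (trans lower-a (trans (cong height Cq) h))))
    ... | inj₂ (j' , j≡1+j' , Ca , _) = j' , j≡1+j' , Ca
    lower-unique : ∀ a b q → E (C q) (C a) → E (C q) (C b) →
                   suc (height (C a)) ≡ height (C q) → suc (height (C b)) ≡ height (C q) → C a ≡ C b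
    lower-unique a b q ea eb fa fb with located q
    ... | i , j , Cq , h with lower a q Cq h ea fa | lower b q Cq h eb fb
    ...   | j₁ , j≡1+j₁ , Ca | j₂ , j≡1+j₂ , Cb =
            trans Ca (trans (cong (at i) (suc-injective (trans (sym j≡1+j₁) j≡1+j₂))) (sym Cb))

  module From (p : ℕ) where

    D : ℕ → V
    D k = C (p + k)

    D≡C : ∀ k → D k ≡ C (k + p)
    D≡C k = cong C (+-comm p k)

    D-edge : ∀ k → E (D k) (D (suc k))
    D-edge k = subst (E (D k) ∘ C) (sym (+-suc p k)) (C-edge (p + k))

    D-edge-sym : ∀ a b → E (D a) (D b) → E (D b) (D a)
    D-edge-sym a b = C-edge-sym (p + a) (p + b)

    D-wraps : D L ≡ D 0
    D-wraps = trans (cong C (+-comm p L)) (trans (C-periodic p) (cong C (sym (+-identityʳ p))))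

    D-distinct : ∀ {a b} → a < b → b < L → D a ≢ D b
    D-distinct {a} {b} a<b b<L = C-distinct p a b a<b (≤-trans b<L (m≤n+m L a))

    D-no-chord : ∀ {a b} → suc a < b → suc b < a + L → ¬ E (D a) (D b)
    D-no-chord {a} {b} = C-no-chord p a b

    follow : (w : ℕ → V) (i K : ℕ) → InteriorConfined w K →
             D i ≡ w 0 → D (suc i) ≡ w 1 → ∀ j → j ≤ K → D (i + j) ≡ w j
    follow w i K confined Dᵢ Dᵢ₊₁ j j≤K =
      trans (cong C (sym (+-assoc p i j)))
            (follow-path w (p + i) K confined Dᵢ (trans (cong C (sym (+-suc p i))) Dᵢ₊₁) j j≤K)

-- Throughout, t = r + 5: then s = t - 3 is half the length of the paths P_i and the number of
-- vertices of the paths Q_i, and L = 2t - 2 = 2s + 4 is the length of the forbidden cycle.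
module Sizes (r : ℕ) where

  s : ℕ
  s = 2 + r

  t : ℕ
  t = 3 + s

  L : ℕ
  L = 4 + (s + s)

  s+s≡suc[s+suc[r]] : s + s ≡ suc (s + suc r)
  s+s≡suc[s+suc[r]] = cong (suc ∘ suc) (+-suc r (suc r))

  suc[r]+suc[s]≡s+s : suc r + suc s ≡ s + s
  suc[r]+suc[s]≡s+s = cong suc (+-suc r s)

  suc[s]<s+s : suc s < s + s
  suc[s]<s+s = s≤s (s≤s (m≤n+m s r))

  s<s+s : s < s + s
  s<s+s = <-trans (n<1+n s) suc[s]<s+s

  suc[r]<s+s : suc r < s + s
  suc[r]<s+s = <-trans (n<1+n (suc r)) s<s+s

  r<s+s : r < s + s
  r<s+s = <-trans (n<1+n r) suc[r]<s+s

  s+s∸s≡s : s + s ∸ s ≡ s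
  s+s∸s≡s = m+n∸n≡m s s

  s+s∸suc[r]≡suc[s] : s + s ∸ suc r ≡ suc s
  s+s∸suc[r]≡suc[s] = trans (cong (_∸ suc r) (sym suc[r]+suc[s]≡s+s)) (m+n∸m≡n (suc r) (suc s))

  s+s∸suc[s]≡suc[r] : s + s ∸ suc s ≡ suc r
  s+s∸suc[s]≡suc[r] = trans (cong (_∸ suc s) s+s≡suc[s+suc[r]]) (m+n∸m≡n (suc s) (suc r))

  k+s<L : ∀ {k} → k < 4 → k + s < L
  k+s<L k<4 = +-mono-<-≤ k<4 (m≤m+n s s)

  k+[s+s]<L : ∀ {k} → k < 4 → k + (s + s) < L
  k+[s+s]<L k<4 = +-monoˡ-< (s + s) k<4

module Segments (r : ℕ) {V : Set} {E : V → V → Set} (cy : InducedCycle E (Sizes.L r)) (p : ℕ) where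
  open Sizes r
  open OnCycle (s≤s (s≤s (s≤s z≤n))) cy
  open From p

  -- Turning from w s onto u₁ would make u₀ u₁ a chord.
  runs-past-midpoint : ∀ {u₀ u₁} (w : ℕ → V) (X : V → Set) →
    D 0 ≡ u₀ → D 1 ≡ w 0 → D 2 ≡ w 1 → InteriorConfined w s →
    (∀ k → E (w s) (C k) → C k ≡ w (pred s) ⊎ C k ≡ u₁ ⊎ X (C k)) →
    E u₀ u₁ → X (D (2 + s))
  runs-past-midpoint {u₀} {u₁} w X D₀ D₁ D₂ confined mid-nbrs u₀u₁ = leave (mid-nbrs (p + (2 + s)) out)
    where
    along : ∀ j → j ≤ s → D (suc j) ≡ w j
    along = follow w 1 s confined D₁ D₂
    out : E (w s) (D (2 + s))
    out = subst (λ v → E v (D (2 + s))) (along s ≤-refl) (D-edge (suc s))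
    leave : D (2 + s) ≡ w (pred s) ⊎ D (2 + s) ≡ u₁ ⊎ X (D (2 + s)) → X (D (2 + s))
    leave (inj₂ (inj₂ x)) = x
    leave (inj₁ back) = ⊥-elim (D-distinct {s} {2 + s} (m<n+m s {2} z<s) (k+s<L (s<s (s<s z<s)))
                                  (trans (along (suc r) (n≤1+n _)) (sym back)))
    leave (inj₂ (inj₁ anchor)) = ⊥-elim (D-no-chord (s<s z<s) (k+s<L (s<s (s<s (s<s z<s))))
                                          (subst₂ E (sym D₀) (sym anchor) u₀u₁))

  -- The cycle has to run along all of w. Stepping from w (2s) onto u₂ would make the next vertex a common
  -- neighbour of u₂ and u₀, that is u₁, which is adjacent to w s: a chord.
  bridge-absurd : ∀ {u₀ u₁ u₂} (w : ℕ → V) (Beyond : V → Set) →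
    D 0 ≡ u₀ → D 1 ≡ w 0 → D 2 ≡ w 1 →
    (∀ j k → 0 < j → j < s + s → j ≢ s → E (w j) (C k) → C k ≡ w (pred j) ⊎ C k ≡ w (suc j)) →
    (∀ k → E (w s) (C k) → C k ≡ w (pred s) ⊎ C k ≡ u₁ ⊎ C k ≡ w (suc s)) →
    (∀ k → E (w (s + s)) (C k) → C k ≡ w (pred (s + s)) ⊎ C k ≡ u₂ ⊎ Beyond (C k)) →
    (D (1 + (s + s)) ≡ w (s + s) → ¬ Beyond (D (2 + (s + s)))) →
    E u₀ u₁ → E u₁ (w s) → (∀ k → E u₂ (C k) → E (C k) u₀ → C k ≡ u₁) → ⊥
  bridge-absurd {u₀} {u₁} {u₂} w Beyond D₀ D₁ D₂ inner-nbrs mid-nbrs end-nbrs not-beyond u₀u₁ u₁wₛ only-u₁ =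
    leave (end-nbrs (p + (2 + (s + s))) (subst (λ v → E v _) at-end (D-edge (1 + (s + s)))))
    where
    first-half : InteriorConfined w s
    first-half j k 0<j j<s = inner-nbrs j k 0<j (≤-trans j<s (m≤m+n s s)) (<⇒≢ j<s)
    along₁ : ∀ j → j ≤ s → D (suc j) ≡ w j
    along₁ = follow w 1 s first-half D₁ D₂
    second-half : InteriorConfined (λ j → w (j + s)) s
    second-half (suc j) k _ j<s = inner-nbrs (suc j + s) k z<s (+-monoˡ-< s j<s) (>⇒≢ (m<n+m s z<s))
    along₂ : ∀ j → j ≤ s → D (suc s + j) ≡ w (j + s)
    along₂ = follow (λ j → w (j + s)) (suc s) s second-half (along₁ s ≤-refl)
               (runs-past-midpoint w (_≡ w (suc s)) D₀ D₁ D₂ first-half mid-nbrs u₀u₁)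
    at-end : D (1 + (s + s)) ≡ w (s + s)
    at-end = along₂ s ≤-refl
    leave : D (2 + (s + s)) ≡ w (pred (s + s)) ⊎ D (2 + (s + s)) ≡ u₂ ⊎ Beyond (D (2 + (s + s))) → ⊥
    leave (inj₂ (inj₂ beyond)) = not-beyond at-end beyond
    leave (inj₁ back) = D-distinct {s + s} {2 + (s + s)} (m<n+m (s + s) {2} z<s) (k+[s+s]<L (s<s (s<s z<s)))
      (trans (cong D s+s≡suc[s+suc[r]]) (trans (along₂ (suc r) (n≤1+n _)) (sym back)))
    leave (inj₂ (inj₁ at-u₂)) = D-no-chord {suc s} {3 + (s + s)}
      (s<s (s<s (s<s (m≤m+n s s)))) (s≤s (m≤n+m L s))
      (D-edge-sym (3 + (s + s)) (suc s) (subst₂ E (sym D₃) (sym (along₁ s ≤-refl)) u₁wₛ))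
      where
      D₃ : D (3 + (s + s)) ≡ u₁
      D₃ = only-u₁ (p + (3 + (s + s))) (subst (λ v → E v _) at-u₂ (D-edge (2 + (s + s))))
                                       (subst (E _) (trans D-wraps D₀) (D-edge (3 + (s + s))))

  -- The vertex after w (2s+1) would be w (2s+2), adjacent to u₀ and hence equal to the visited w 0.
  overshoot-absurd : ∀ {u₀} (w : ℕ → V) → D 0 ≡ u₀ → D 1 ≡ w 0 →
    D (1 + (s + s)) ≡ w (s + s) → D (2 + (s + s)) ≡ w (1 + (s + s)) →
    (∀ k → E (w (1 + (s + s))) (C k) → C k ≡ w (s + s) ⊎ C k ≡ w (2 + (s + s))) →
    (E (w (2 + (s + s))) u₀ → w (2 + (s + s)) ≡ w 0) → ⊥
  overshoot-absurd {u₀} w D₀ D₁ at-2s at-2s+1 nbrs closes =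
    leave (nbrs (p + (3 + (s + s))) (subst (λ v → E v _) at-2s+1 (D-edge (2 + (s + s)))))
    where
    leave : D (3 + (s + s)) ≡ w (s + s) ⊎ D (3 + (s + s)) ≡ w (2 + (s + s)) → ⊥
    leave (inj₁ back) = D-distinct {1 + (s + s)} {3 + (s + s)} (n≤1+n _) ≤-refl (trans at-2s (sym back))
    leave (inj₂ on) = D-distinct {1} {3 + (s + s)} (s<s z<s) ≤-refl
      (trans D₁ (sym (trans on (closes (subst (E _) (trans D-wraps D₀) (subst (λ v → E v _) on (D-edge (3 + (s + s)))))))))

  -- The cycle leaves v⁻ = P (s-1) onto the path Q, which ends next to v⁺ = P (s+1): it has to continue
  -- along P to P (2s) and x⁺, and then cannot get back to v⁻ in the two remaining steps.
  module Detour {x⁻ x⁺ : V} (P Q : ℕ → V) (D₀ : D 0 ≡ P (suc r)) (D₁ : D 1 ≡ Q 0)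
    (Q₀-nbrs : ∀ k → E (Q 0) (C k) → C k ≡ P (suc r) ⊎ C k ≡ Q 1)
    (Q-inner : InteriorConfined Q (suc r))
    (Qₑ-nbrs : ∀ k → E (Q (suc r)) (C k) → C k ≡ Q r ⊎ C k ≡ P (suc s))
    (v⁺-nbrs : ∀ k → E (P (suc s)) (C k) → C k ≡ P s ⊎ C k ≡ P (2 + s) ⊎ C k ≡ Q (suc r))
    (P-inner : ∀ j k → suc s < j → j < s + s → E (P j) (C k) → C k ≡ P (pred j) ⊎ C k ≡ P (suc j))
    (Pₑ-nbrs : ∀ k → E (P (s + s)) (C k) → C k ≡ P (pred (s + s)) ⊎ C k ≡ x⁺)
    (v⁻-nbrs : ∀ k → E (P (suc r)) (C k) → C k ≡ P r ⊎ C k ≡ P s ⊎ C k ≡ Q 0)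
    (Pᵣ-nbrs : ∀ k → E (P r) (C k) → C k ≡ P (pred r) ⊎ C k ≡ P (suc r) ⊎ C k ≡ x⁻)
    (v⁻y : E (P (suc r)) (P s)) (yv⁺ : E (P s) (P (suc s)))
    (x⁺≁P : ∀ j → j < s + s → ¬ E x⁺ (P j)) (x⁺≁x⁻ : ¬ E x⁺ x⁻) where

    private
      step : ∀ {k v} → D k ≡ v → E v (D (suc k))
      step {k} Dₖ = subst (λ v → E v _) Dₖ (D-edge k)

    along-Q : ∀ j → j ≤ suc r → D (suc j) ≡ Q j
    along-Q = follow Q 1 (suc r) Q-inner D₁ D₂
      where
      D₂ : D 2 ≡ Q 1
      D₂ with Q₀-nbrs (p + 2) (step D₁)
      ... | inj₂ on = on
      ... | inj₁ back = ⊥-elim (D-distinct {0} {2} z<s (s<s (s<s z<s)) (trans D₀ (sym back)))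

    at-v⁺ : D (suc s) ≡ P (suc s)
    at-v⁺ with Qₑ-nbrs (p + suc s) (step (along-Q (suc r) ≤-refl))
    ... | inj₂ on = on
    ... | inj₁ back = ⊥-elim (D-distinct {suc r} {suc s} (s<s (m<n+m r {2} z<s)) (k+s<L (s<s z<s))
                                (trans (along-Q r (n≤1+n r)) (sym back)))

    along-P : ∀ j → j ≤ suc r → D (suc s + j) ≡ P (j + suc s)
    along-P = follow (λ j → P (j + suc s)) (suc s) (suc r) P-confined at-v⁺ past-v⁺
      where
      past-v⁺ : D (2 + s) ≡ P (2 + s)
      past-v⁺ with v⁺-nbrs (p + (2 + s)) (step at-v⁺)
      ... | inj₂ (inj₁ on) = on
      ... | inj₁ at-y = ⊥-elim (D-no-chord (s<s z<s) (k+s<L (s<s (s<s (s<s z<s)))) (subst₂ E (sym D₀) (sym at-y) v⁻y))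
      ... | inj₂ (inj₂ back) = ⊥-elim (D-distinct {s} {2 + s} (m<n+m s {2} z<s) (k+s<L (s<s (s<s z<s)))
                                         (trans (along-Q (suc r) ≤-refl) (sym back)))
      P-confined : InteriorConfined (λ j → P (j + suc s)) (suc r)
      P-confined (suc j) k _ j<r = P-inner (suc j + suc s) k (m<n+m (suc s) z<s)
                                     (subst (suc j + suc s <_) suc[r]+suc[s]≡s+s (+-monoˡ-< (suc s) j<r))

    at-x⁺ : D (1 + (s + s)) ≡ x⁺
    at-x⁺ with Pₑ-nbrs (p + (1 + (s + s))) (step at-y⁺)
      where
      at-y⁺ : D (s + s) ≡ P (s + s)
      at-y⁺ = trans (cong D s+s≡suc[s+suc[r]]) (trans (along-P (suc r) ≤-refl) (cong P suc[r]+suc[s]≡s+s))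
    ... | inj₂ on = on
    ... | inj₁ back = ⊥-elim (D-distinct {pred (s + s)} {1 + (s + s)} (n≤1+n _) (k+[s+s]<L (s<s z<s))
                                (trans (cong D (cong suc (+-comm r s))) (trans (along-P r (n≤1+n r)) (trans (cong P (+-suc r s)) (sym back)))))

    cannot-close : ⊥
    cannot-close = close (v⁻-nbrs (p + (3 + (s + s))) (subst (λ v → E v _) (trans D-wraps D₀) (D-edge-sym _ _ (D-edge (3 + (s + s))))))
      where
      close : D (3 + (s + s)) ≡ P r ⊎ D (3 + (s + s)) ≡ P s ⊎ D (3 + (s + s)) ≡ Q 0 → ⊥
      close (inj₂ (inj₂ at-z⁻)) = D-distinct {1} {3 + (s + s)} (s<s z<s) ≤-refl (trans D₁ (sym at-z⁻))
      close (inj₂ (inj₁ at-y)) = D-no-chord {suc s} {3 + (s + s)} (s<s (s<s (s<s (m≤m+n s s)))) (s≤s (m≤n+m L s))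
        (D-edge-sym (3 + (s + s)) (suc s) (subst₂ E (sym at-y) (sym at-v⁺) yv⁺))
      close (inj₁ at-Pᵣ) with Pᵣ-nbrs (p + (2 + (s + s))) (subst (λ v → E v _) at-Pᵣ (D-edge-sym _ _ (D-edge (2 + (s + s)))))
      ... | inj₁ at-Pᵣ₋₁ = x⁺≁P (pred r) (≤-trans (s≤s pred[n]≤n) (≤-trans (n≤1+n (suc r)) (m≤m+n s s)))
                              (subst₂ E at-x⁺ at-Pᵣ₋₁ (D-edge (1 + (s + s))))
      ... | inj₂ (inj₁ at-v⁻) = D-distinct {0} {2 + (s + s)} z<s (k+[s+s]<L (s<s (s<s z<s))) (trans D₀ (sym at-v⁻))
      ... | inj₂ (inj₂ at-x⁻) = x⁺≁x⁻ (subst₂ E at-x⁺ at-x⁻ (D-edge (1 + (s + s))))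

-- The territories T_m

module Tower (r : ℕ) where
  open Sizes r

  TmE : (m : ℕ) → TmV t m → TmV t m → Set
  TmE m a b = TmD t m a b ⊎ TmD t m b a

  TmE-sym : ∀ m {a b} → TmE m a b → TmE m b a
  TmE-sym m = Sum.swap

  len≥5 : ∀ m → 5 ≤ len t m
  len≥5 m = ≤-trans (s≤s (s≤s (s≤s (s≤s (s≤s z≤n))))) (m≤m*n t (s ^ m) {{m^n≢0 s m}})

  len-nonZero : ∀ m → NonZero (len t m)
  len-nonZero m = >-nonZero (≤-trans (s≤s z≤n) (len≥5 m))

  toℕ-enum₀ : ∀ a → toℕ (enum t 0 a) ≡ toℕ a
  toℕ-enum₀ = toℕ-cast (*-identityʳ t)

  enum-injective : ∀ m {a b} → enum t m a ≡ enum t m b → a ≡ b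
  enum-injective zero {a} {b} e = toℕ-injective (trans (sym (toℕ-enum₀ a)) (trans (cong toℕ e) (toℕ-enum₀ b)))
  enum-injective (suc m) refl = refl

  boundary-enum : ∀ m v → TmB t m v → Σ (Fin (len t m)) λ a → v ≡ enum t m a
  boundary-enum zero v _ = cast (sym (*-identityʳ t)) v , toℕ-injective (sym (trans (toℕ-enum₀ _) (toℕ-cast (sym (*-identityʳ t)) v)))
  boundary-enum (suc m) (inj₂ q) _ = q , refl

  enum-adj⇒CycAdj : ∀ m {a b} → TmE m (enum t m a) (enum t m b) → CycAdj (len t m) a b
  enum-adj⇒CycAdj zero {a} {b} (inj₁ h) = CycAdj-cast (sym (*-identityʳ t)) (toℕ-enum₀ a) (toℕ-enum₀ b) h
  enum-adj⇒CycAdj zero {a} {b} (inj₂ h) = CycAdj-sym (CycAdj-cast (sym (*-identityʳ t)) (toℕ-enum₀ b) (toℕ-enum₀ a) h)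
  enum-adj⇒CycAdj (suc m) (inj₁ h) = h
  enum-adj⇒CycAdj (suc m) (inj₂ h) = CycAdj-sym h

  CycAdj⇒enum-adj : ∀ m {a b} → CycAdj (len t m) a b → TmE m (enum t m a) (enum t m b)
  CycAdj⇒enum-adj zero {a} {b} h = inj₁ (CycAdj-cast (*-identityʳ t) (sym (toℕ-enum₀ a)) (sym (toℕ-enum₀ b)) h)
  CycAdj⇒enum-adj (suc m) h = inj₁ h

  -- The vertex a = x_i' of B_m is attached to v = x_i on B_(m-1).
  Attached : (m : ℕ) → Fin (len t m) → TmV t m → Set
  Attached zero _ _ = ⊥
  Attached (suc m) a v = Σ (Fin (len t m)) λ i → (v ≡ inj₁ (enum t m i)) × (toℕ a ≡ toℕ i * s)

  enum-nbrs : ∀ m a v → TmE m (enum t m a) v →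
              (Σ (Fin (len t m)) λ b → (v ≡ enum t m b) × CycAdj (len t m) a b) ⊎ Attached m a v
  enum-nbrs zero a v h with boundary-enum zero v tt
  ... | b , refl = inj₁ (b , refl , enum-adj⇒CycAdj zero h)
  enum-nbrs (suc m) a (inj₂ b) h = inj₁ (b , refl , enum-adj⇒CycAdj (suc m) h)
  enum-nbrs (suc m) a (inj₁ u) (inj₂ (i , u≡xᵢ , a≡is)) = inj₂ (i , cong inj₁ u≡xᵢ , a≡is)

  Attached-injective : ∀ m {a c v} → Attached m a v → Attached m c v → a ≡ c
  Attached-injective (suc m) (i , v≡xᵢ , a≡is) (i' , v≡xᵢ' , c≡i's)
    with enum-injective m (inj₁-injective (trans (sym v≡xᵢ) v≡xᵢ'))
  ... | refl = toℕ-injective (trans a≡is (sym c≡i's))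

  enum-not-attached : ∀ m {a b v} → v ≡ enum t m b → ¬ Attached m a v
  enum-not-attached (suc m) refl (_ , () , _)

  enum-common-neighbour : ∀ m {a b c} v → CycAdj (len t m) b a → CycAdj (len t m) b c → a ≢ c →
                          TmE m (enum t m a) v → TmE m (enum t m c) v → v ≡ enum t m b
  enum-common-neighbour m {a} {b} {c} v ba bc a≢c av cv = go (enum-nbrs m a v av) (enum-nbrs m c v cv)
    where
    open CyclicOrder (len t m) {{len-nonZero m}} (len≥5 m)
    go : (Σ (Fin (len t m)) λ b → (v ≡ enum t m b) × CycAdj (len t m) a b) ⊎ Attached m a v →
         (Σ (Fin (len t m)) λ b → (v ≡ enum t m b) × CycAdj (len t m) c b) ⊎ Attached m c v → v ≡ enum t m b
    go (inj₁ (b₁ , v≡b₁ , ab₁)) (inj₁ (b₂ , v≡b₂ , cb₂)) with enum-injective m (trans (sym v≡b₁) v≡b₂)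
    ... | refl = trans v≡b₁ (cong (enum t m) (CycAdj-common-neighbour ba bc a≢c ab₁ cb₂))
    go (inj₁ (_ , v≡b₁ , _)) (inj₂ att) = ⊥-elim (enum-not-attached m v≡b₁ att)
    go (inj₂ att) (inj₁ (_ , v≡b₂ , _)) = ⊥-elim (enum-not-attached m v≡b₂ att)
    go (inj₂ att₁) (inj₂ att₂) = ⊥-elim (a≢c (Attached-injective m att₁ att₂))

-- The new outer cycle B_(m+1), of length N = M s, where vertex i s is attached to x_i on B_m.
module NewLayer (r m : ℕ) where
  open Sizes r
  open Tower r

  M N : ℕ
  M = len t m
  N = len t (suc m)

  instance
    M-nonZero : NonZero M
    M-nonZero = len-nonZero m
    N-nonZero : NonZero N
    N-nonZero = len-nonZero (suc m)

  N≡M*s : N ≡ M * s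
  N≡M*s = trans (cong (t *_) (*-comm s (s ^ m))) (sym (*-assoc t (s ^ m) s))

  1≤N : 1 ≤ N
  1≤N = ≤-trans (s≤s z≤n) (len≥5 (suc m))

  2<M : 2 < M
  2<M = ≤-trans (s≤s (s≤s (s≤s z≤n))) (len≥5 m)

  modN : ℕ → Fin N
  modN x = fromℕ< (m%n<n x N)

  modM : ℕ → Fin M
  modM x = fromℕ< (m%n<n x M)

  toℕ-modN : ∀ x → toℕ (modN x) ≡ x % N
  toℕ-modN x = toℕ-fromℕ< _

  toℕ-modM : ∀ x → toℕ (modM x) ≡ x % M
  toℕ-modM x = toℕ-fromℕ< _

  modN-cong : ∀ {x y} → x % N ≡ y % N → modN x ≡ modN y
  modN-cong {x} {y} e = toℕ-injective (trans (toℕ-modN x) (trans e (sym (toℕ-modN y))))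

  modN-toℕ : ∀ q → modN (toℕ q) ≡ q
  modN-toℕ q = toℕ-injective (trans (toℕ-modN (toℕ q)) (m<n⇒m%n≡m (toℕ<n q)))

  modM-toℕ : ∀ a → modM (toℕ a) ≡ a
  modM-toℕ a = toℕ-injective (trans (toℕ-modM (toℕ a)) (m<n⇒m%n≡m (toℕ<n a)))

  module OuterOrder = CyclicOrder N (len≥5 (suc m))
  module InnerOrder = CyclicOrder M (len≥5 m)

  outer-nbrs : ∀ x v → TmE (suc m) (inj₂ (modN x)) v →
    v ≡ inj₂ (modN (x + 1)) ⊎ v ≡ inj₂ (modN (x + (N ∸ 1))) ⊎
    Σ (Fin M) λ i → (v ≡ inj₁ (enum t m i)) × (x % N ≡ toℕ i * s)
  outer-nbrs x (inj₁ u) (inj₂ (i , u≡xᵢ , x≡is)) = inj₂ (inj₂ (i , cong inj₁ u≡xᵢ , trans (sym (toℕ-modN x)) x≡is))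
  outer-nbrs x (inj₂ q) h = along-B (OuterOrder.CycAdj⇒Ahead (Sum.[ (λ a → a) , CycAdj-sym ] h))
    where
    along-B : OuterOrder.Ahead 1 (modN x) q ⊎ OuterOrder.Ahead 1 q (modN x) → _
    along-B (inj₁ e) = inj₁ (cong inj₂ (toℕ-injective (trans e (trans (cong (λ z → (z + 1) % N) (toℕ-modN x))
                         (trans ([m%n+k]%n≡[m+k]%n x 1 N) (sym (toℕ-modN (x + 1))))))))
    along-B (inj₂ e) = inj₂ (inj₁ (cong inj₂ (toℕ-injective (trans ([p+a]%n≡[p+b]%n⇒a≡b 1 (toℕ<n q) (m%n<n _ N) back)
                         (sym (toℕ-modN _))))))
      where
      back : (1 + toℕ q) % N ≡ (1 + (x + (N ∸ 1)) % N) % N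
      back = begin
        (1 + toℕ q) % N                  ≡⟨ cong (_% N) (+-comm 1 (toℕ q)) ⟩
        (toℕ q + 1) % N                  ≡⟨ e ⟨
        toℕ (modN x)                     ≡⟨ toℕ-modN x ⟩
        x % N                            ≡⟨ [m+n]%n≡m%n x N ⟨
        (x + N) % N                      ≡⟨ cong (λ z → (x + z) % N) (m∸n+n≡m 1≤N) ⟨
        (x + (N ∸ 1 + 1)) % N            ≡⟨ cong (_% N) (+-assoc x (N ∸ 1) 1) ⟨
        (x + (N ∸ 1) + 1) % N            ≡⟨ [m%n+k]%n≡[m+k]%n (x + (N ∸ 1)) 1 N ⟨
        ((x + (N ∸ 1)) % N + 1) % N      ≡⟨ cong (_% N) (+-comm _ 1) ⟩
        (1 + (x + (N ∸ 1)) % N) % N      ∎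
        where open ≡-Reasoning

  attachment-position : ∀ a q → TmE (suc m) (inj₁ (enum t m a)) (inj₂ q) → toℕ q ≡ toℕ a * s
  attachment-position a q (inj₁ (i , a≡i , q≡is)) with enum-injective m a≡i
  ... | refl = q≡is

  [y*s]%N≡[y%M]*s : ∀ y → (y * s) % N ≡ (y % M) * s
  [y*s]%N≡[y%M]*s y = begin
    (y * s) % N        ≡⟨ %-congʳ N≡M*s ⟩
    (y * s) % (M * s)  ≡⟨ m%n*o≡m*o%[n*o] y M s ⟨
    (y % M) * s        ∎
    where
    open ≡-Reasoning
    instance
      M*s-nonZero : NonZero (M * s)
      M*s-nonZero = m*n≢0 M s

  [x%N]%s≡x%s : ∀ x → (x % N) % s ≡ x % s
  [x%N]%s≡x%s x = m∣n⇒o%n%m≡o%m s N x (divides M N≡M*s)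

  [N*j]%s≡0 : ∀ j → (N * j) % s ≡ 0
  [N*j]%s≡0 j = trans (cong (λ n → (n * j) % s) N≡M*s)
                      (trans (cong (_% s) (*-swap M s j)) (m*n%n≡0 (M * j) s))
    where
    *-swap : ∀ a b c → a * b * c ≡ a * c * b
    *-swap = solve-∀

  [y+N]%M≡y%M : ∀ y → (y + N) % M ≡ y % M
  [y+N]%M≡y%M y = trans (cong (λ n → (y + n) % M) (trans N≡M*s (*-comm M s))) ([m+kn]%n≡m%n y s M)

  -- δ is one step along B_(m+1) in the direction of travel, δ̄ one step back.
  Direction : ℕ → ℕ → Set
  Direction δ δ̄ = (δ ≡ 1 × δ̄ ≡ N ∸ 1) ⊎ (δ ≡ N ∸ 1 × δ̄ ≡ 1)

  Direction-sum : ∀ {δ δ̄} → Direction δ δ̄ → δ + δ̄ ≡ N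
  Direction-sum (inj₁ (refl , refl)) = m+[n∸m]≡n 1≤N
  Direction-sum (inj₂ (refl , refl)) = m∸n+n≡m 1≤N

  outer-nbrs-dir : ∀ {δ δ̄} → Direction δ δ̄ → ∀ x v → TmE (suc m) (inj₂ (modN x)) v →
    v ≡ inj₂ (modN (x + δ)) ⊎ v ≡ inj₂ (modN (x + δ̄)) ⊎ Σ (Fin M) λ i → (v ≡ inj₁ (enum t m i)) × (x % N ≡ toℕ i * s)
  outer-nbrs-dir dir x v h with outer-nbrs x v h | dir
  ... | inj₂ (inj₂ att) | _ = inj₂ (inj₂ att)
  ... | inj₁ e | inj₁ (refl , refl) = inj₁ e
  ... | inj₁ e | inj₂ (refl , refl) = inj₂ (inj₁ e)
  ... | inj₂ (inj₁ e) | inj₁ (refl , refl) = inj₂ (inj₁ e)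
  ... | inj₂ (inj₁ e) | inj₂ (refl , refl) = inj₁ e

  δj%s≡0⇒j%s≡0 : ∀ {δ δ̄} → Direction δ δ̄ → ∀ j → (δ * j) % s ≡ 0 → j % s ≡ 0
  δj%s≡0⇒j%s≡0 (inj₁ (refl , _)) j e = trans (cong (_% s) (sym (+-identityʳ j))) e
  δj%s≡0⇒j%s≡0 {δ} dir@(inj₂ (refl , refl)) j e = begin
    j % s                          ≡⟨ cong (λ z → (z + j) % s) e ⟨
    ((δ * j) % s + j) % s          ≡⟨ [m%n+k]%n≡[m+k]%n (δ * j) j s ⟩
    (δ * j + j) % s                ≡⟨ cong (_% s) (trans (cong (δ * j +_) (sym (*-identityˡ j))) (sym (*-distribʳ-+ j δ 1))) ⟩
    ((δ + 1) * j) % s              ≡⟨ cong (λ z → (z * j) % s) (Direction-sum dir) ⟩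
    (N * j) % s                    ≡⟨ [N*j]%s≡0 j ⟩
    0                              ∎
    where open ≡-Reasoning

  inner-step : ∀ {δ δ̄} → Direction δ δ̄ →
    (∀ y → InnerOrder.Ahead 1 (modM y) (modM (y + δ))) ⊎ (∀ y → InnerOrder.Ahead 1 (modM (y + δ)) (modM y))
  inner-step (inj₁ (refl , refl)) = inj₁ λ y →
    trans (toℕ-modM (y + 1)) (sym (trans (cong (λ z → (z + 1) % M) (toℕ-modM y)) ([m%n+k]%n≡[m+k]%n y 1 M)))
  inner-step {δ} dir@(inj₂ (refl , refl)) = inj₂ λ y → begin
    toℕ (modM y)                    ≡⟨ toℕ-modM y ⟩
    y % M                           ≡⟨ [y+N]%M≡y%M y ⟨
    (y + N) % M                     ≡⟨ cong (λ z → (y + z) % M) (Direction-sum dir) ⟨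
    (y + (δ + 1)) % M               ≡⟨ cong (_% M) (+-assoc y δ 1) ⟨
    (y + δ + 1) % M                 ≡⟨ [m%n+k]%n≡[m+k]%n (y + δ) 1 M ⟨
    ((y + δ) % M + 1) % M           ≡⟨ cong (λ z → (z + 1) % M) (toℕ-modM (y + δ)) ⟨
    (toℕ (modM (y + δ)) + 1) % M    ∎
    where open ≡-Reasoning

  pos-never-returns : ∀ {δ δ̄} → Direction δ δ̄ → ∀ x k → 0 < k → k < N → (x + δ * k) % N ≢ x % N
  pos-never-returns (inj₁ (refl , _)) x k 0<k k<N e =
    [p+a]%n≢[p+b]%n x 0<k k<N (trans (cong (_% N) (+-identityʳ x)) (sym (trans (cong (λ z → (x + z) % N) (sym (*-identityˡ k))) e)))
  pos-never-returns {δ} dir@(inj₂ (_ , refl)) x k 0<k k<N e = [p+a]%n≢[p+b]%n x 0<k k<N (begin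
    (x + 0) % N              ≡⟨ cong (_% N) (+-identityʳ x) ⟩
    x % N                    ≡⟨ [m+kn]%n≡m%n x k N ⟨
    (x + k * N) % N          ≡⟨ cong (λ n → (x + k * n) % N) (Direction-sum dir) ⟨
    (x + k * (δ + 1)) % N    ≡⟨ cong (_% N) (regroup x δ k) ⟨
    (x + δ * k + k) % N      ≡⟨ [m%n+k]%n≡[m+k]%n (x + δ * k) k N ⟨
    ((x + δ * k) % N + k) % N ≡⟨ cong (λ z → (z + k) % N) e ⟩
    (x % N + k) % N          ≡⟨ [m%n+k]%n≡[m+k]%n x k N ⟩
    (x + k) % N              ∎)
    where
    open ≡-Reasoning
    regroup : ∀ x δ k → x + δ * k + k ≡ x + k * (δ + 1)
    regroup = solve-∀

  module Walking {δ δ̄ : ℕ} (dir : Direction δ δ̄) where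

    pos : ℕ → ℕ → ℕ
    pos b j = b + δ * j

    pos-suc : ∀ b j → pos b j + δ ≡ pos b (suc j)
    pos-suc b j = trans (+-assoc b (δ * j) δ) (cong (b +_) (trans (+-comm (δ * j) δ) (sym (*-suc δ j))))

    pos-back : ∀ b j → (pos b (suc j) + δ̄) % N ≡ pos b j % N
    pos-back b j = trans (cong (_% N) (trans (shuffle b δ δ̄ j) (cong (pos b j +_) (Direction-sum dir)))) ([m+n]%n≡m%n _ N)
      where
      shuffle : ∀ b δ δ̄ j → b + δ * suc j + δ̄ ≡ b + δ * j + (δ + δ̄)
      shuffle = solve-∀

    walk-nbrs : ∀ b j v → TmE (suc m) (inj₂ (modN (pos b (suc j)))) v →
      v ≡ inj₂ (modN (pos b j)) ⊎ v ≡ inj₂ (modN (pos b (2 + j))) ⊎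
      Σ (Fin M) λ i → (v ≡ inj₁ (enum t m i)) × (pos b (suc j) % N ≡ toℕ i * s)
    walk-nbrs b j v h with outer-nbrs-dir dir (pos b (suc j)) v h
    ... | inj₁ e = inj₂ (inj₁ (trans e (cong (inj₂ ∘ modN) (pos-suc b (suc j)))))
    ... | inj₂ (inj₁ e) = inj₁ (trans e (cong inj₂ (modN-cong (pos-back b j))))
    ... | inj₂ (inj₂ att) = inj₂ (inj₂ att)

    unattached : ∀ b j (i : Fin M) → b % s ≡ 0 → j % s ≢ 0 → pos b j % N ≢ toℕ i * s
    unattached b j i b%s≡0 j%s≢0 e = j%s≢0 (δj%s≡0⇒j%s≡0 dir j (begin
      (δ * j) % s              ≡⟨ cong (λ z → (z + δ * j) % s) b%s≡0 ⟨
      (b % s + δ * j) % s      ≡⟨ [m%n+k]%n≡[m+k]%n b (δ * j) s ⟩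
      pos b j % s              ≡⟨ [x%N]%s≡x%s (pos b j) ⟨
      (pos b j % N) % s        ≡⟨ cong (_% s) e ⟩
      (toℕ i * s) % s          ≡⟨ m*n%n≡0 (toℕ i) s ⟩
      0                        ∎))
      where open ≡-Reasoning

module OuterBridge (r m : ℕ) (cy : InducedCycle (Tower.TmE r (suc m)) (Sizes.L r)) (p : ℕ) where
  open Sizes r
  open Tower r
  open NewLayer r m
  open OnCycle (s≤s (s≤s (s≤s z≤n))) cy
  open From p
  open Segments r cy p

  private
    j%s≢0 : ∀ j → 0 < j → j < s + s → j ≢ s → j % s ≢ 0
    j%s≢0 j 0<j j<s+s j≢s e with <-cmp j s
    ... | tri< j<s _ _ = <⇒≢ 0<j (sym (trans (sym (m<n⇒m%n≡m j<s)) e))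
    ... | tri≈ _ j≡s _ = j≢s j≡s
    ... | tri> _ _ j>s = <⇒≢ (m<n⇒0<n∸m j>s) (sym (begin
      j ∸ s                ≡⟨ m<n⇒m%n≡m (+-cancelʳ-< _ _ s (subst (_< s + s) (sym (m∸n+n≡m (<⇒≤ j>s))) j<s+s)) ⟨
      (j ∸ s) % s          ≡⟨ [m+n]%n≡m%n (j ∸ s) s ⟨
      (j ∸ s + s) % s      ≡⟨ cong (_% s) (m∸n+n≡m (<⇒≤ j>s)) ⟩
      j % s                ≡⟨ e ⟩
      0                    ∎))
      where open ≡-Reasoning

    [1+s+s]%s≢0 : suc (s + s) % s ≢ 0
    [1+s+s]%s≢0 e = 1+n≢0 (begin
      1                    ≡⟨ m<n⇒m%n≡m {n = s} (s<s (z<s {r})) ⟨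
      1 % s                ≡⟨ [m+kn]%n≡m%n 1 2 s ⟨
      (1 + 2 * s) % s      ≡⟨ cong (λ z → suc (s + z) % s) (+-identityʳ s) ⟩
      suc (s + s) % s      ≡⟨ e ⟩
      0                    ∎)
      where open ≡-Reasoning

  -- The bridge over u₀ u₁ u₂ = x_a x_(a+δ) x_(a+2δ) is the stretch w of B_(m+1) from x'_a to x'_(a+2δ).
  module _ {δ δ̄ : ℕ} (dir : Direction δ δ̄) (a : Fin M) where
    open Walking dir

    b : ℕ
    b = toℕ a * s

    w : ℕ → TmV t (suc m)
    w j = inj₂ (modN (pos b j))

    a₁ a₂ : Fin M
    a₁ = modM (toℕ a + δ)
    a₂ = modM (toℕ a + δ + δ)

    u₀ u₁ u₂ : TmV t (suc m)
    u₀ = inj₁ (enum t m a)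
    u₁ = inj₁ (enum t m a₁)
    u₂ = inj₁ (enum t m a₂)

    a~a₁ : CycAdj M a a₁
    a~a₁ with inner-step dir
    ... | inj₁ fwd = InnerOrder.Ahead⇒CycAdj (subst (λ z → InnerOrder.Ahead 1 z a₁) (modM-toℕ a) (fwd (toℕ a)))
    ... | inj₂ bwd = CycAdj-sym (InnerOrder.Ahead⇒CycAdj (subst (InnerOrder.Ahead 1 a₁) (modM-toℕ a) (bwd (toℕ a))))

    a₁~a₂ : CycAdj M a₁ a₂
    a₁~a₂ with inner-step dir
    ... | inj₁ fwd = InnerOrder.Ahead⇒CycAdj (fwd (toℕ a + δ))
    ... | inj₂ bwd = CycAdj-sym (InnerOrder.Ahead⇒CycAdj (bwd (toℕ a + δ)))

    a₂≢a : a₂ ≢ a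
    a₂≢a a₂≡a with inner-step dir
    ... | inj₁ fwd = InnerOrder.Ahead-irrefl 2 z<s 2<M (subst (InnerOrder.Ahead 2 a) a₂≡a
                       (InnerOrder.Ahead-trans 1 1 (subst (λ z → InnerOrder.Ahead 1 z a₁) (modM-toℕ a) (fwd (toℕ a))) (fwd (toℕ a + δ))))
    ... | inj₂ bwd = InnerOrder.Ahead-irrefl 2 z<s 2<M (subst (λ z → InnerOrder.Ahead 2 z a) a₂≡a
                       (InnerOrder.Ahead-trans 1 1 (bwd (toℕ a + δ)) (subst (InnerOrder.Ahead 1 a₁) (modM-toℕ a) (bwd (toℕ a)))))

    pos-multiple : ∀ k → pos b (k * s) % N ≡ ((toℕ a + δ * k) % M) * s
    pos-multiple k = trans (cong (_% N) (sym (distrib (toℕ a) δ k s))) ([y*s]%N≡[y%M]*s (toℕ a + δ * k))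
      where
      distrib : ∀ a δ k s → (a + δ * k) * s ≡ a * s + δ * (k * s)
      distrib = solve-∀

    pos-s : pos b s % N ≡ toℕ a₁ * s
    pos-s = begin
      pos b s % N                     ≡⟨ cong (λ z → pos b z % N) (+-identityʳ s) ⟨
      pos b (1 * s) % N               ≡⟨ pos-multiple 1 ⟩
      ((toℕ a + δ * 1) % M) * s       ≡⟨ cong (λ z → ((toℕ a + z) % M) * s) (*-identityʳ δ) ⟩
      ((toℕ a + δ) % M) * s           ≡⟨ cong (_* s) (toℕ-modM _) ⟨
      toℕ a₁ * s                      ∎
      where open ≡-Reasoning

    pos-2s : pos b (s + s) % N ≡ toℕ a₂ * s
    pos-2s = begin
      pos b (s + s) % N               ≡⟨ cong (λ z → pos b (s + z) % N) (+-identityʳ s) ⟨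
      pos b (2 * s) % N               ≡⟨ pos-multiple 2 ⟩
      ((toℕ a + δ * 2) % M) * s       ≡⟨ cong (λ z → (z % M) * s) (twice (toℕ a) δ) ⟩
      ((toℕ a + δ + δ) % M) * s       ≡⟨ cong (_* s) (toℕ-modM _) ⟨
      toℕ a₂ * s                      ∎
      where
      open ≡-Reasoning
      twice : ∀ a δ → a + δ * 2 ≡ a + δ + δ
      twice = solve-∀

    pos-0 : pos b 0 % N ≡ b
    pos-0 = trans (cong (_% N) (trans (cong (b +_) (*-zeroʳ δ)) (+-identityʳ b)))
                  (m<n⇒m%n≡m (subst (b <_) (sym N≡M*s) (*-monoˡ-< s (toℕ<n a))))

    attached-unique : ∀ {x} {i j : Fin M} → x ≡ toℕ i * s → x ≡ toℕ j * s → i ≡ j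
    attached-unique eᵢ eⱼ = toℕ-injective (*-cancelʳ-≡ _ _ s (trans (sym eᵢ) eⱼ))

    inner-nbrs : ∀ j k → 0 < j → j < s + s → j ≢ s → TmE (suc m) (w j) (C k) → C k ≡ w (pred j) ⊎ C k ≡ w (suc j)
    inner-nbrs (suc j) k _ j<2s j≢s h with walk-nbrs b j (C k) h
    ... | inj₁ back = inj₁ back
    ... | inj₂ (inj₁ on) = inj₂ on
    ... | inj₂ (inj₂ (i , _ , e)) = ⊥-elim (unattached b (suc j) i (m*n%n≡0 (toℕ a) s) (j%s≢0 (suc j) z<s j<2s j≢s) e)

    mid-nbrs : ∀ k → TmE (suc m) (w s) (C k) → C k ≡ w (pred s) ⊎ C k ≡ u₁ ⊎ C k ≡ w (suc s)
    mid-nbrs k h with walk-nbrs b (suc r) (C k) h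
    ... | inj₁ back = inj₁ back
    ... | inj₂ (inj₁ on) = inj₂ (inj₂ on)
    ... | inj₂ (inj₂ (i , at-xᵢ , e)) = inj₂ (inj₁ (trans at-xᵢ (cong (inj₁ ∘ enum t m) (attached-unique e pos-s))))

    end-nbrs : ∀ k → TmE (suc m) (w (s + s)) (C k) → C k ≡ w (pred (s + s)) ⊎ C k ≡ u₂ ⊎ C k ≡ w (1 + (s + s))
    end-nbrs k h with walk-nbrs b (suc (r + s)) (C k) h
    ... | inj₁ back = inj₁ back
    ... | inj₂ (inj₁ on) = inj₂ (inj₂ on)
    ... | inj₂ (inj₂ (i , at-xᵢ , e)) = inj₂ (inj₁ (trans at-xᵢ (cong (inj₁ ∘ enum t m) (attached-unique e pos-2s))))

    beyond-nbrs : ∀ k → TmE (suc m) (w (1 + (s + s))) (C k) → C k ≡ w (s + s) ⊎ C k ≡ w (2 + (s + s))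
    beyond-nbrs k h with walk-nbrs b (s + s) (C k) h
    ... | inj₁ back = inj₁ back
    ... | inj₂ (inj₁ on) = inj₂ on
    ... | inj₂ (inj₂ (i , _ , e)) = ⊥-elim (unattached b (suc (s + s)) i (m*n%n≡0 (toℕ a) s) [1+s+s]%s≢0 e)

    closes : TmE (suc m) (w (2 + (s + s))) u₀ → w (2 + (s + s)) ≡ w 0
    closes h = cong inj₂ (modN-cong (trans (sym (toℕ-modN _))
                 (trans (attachment-position a _ (TmE-sym (suc m) {w (2 + (s + s))} {u₀} h)) (sym pos-0))))

    only-u₁ : ∀ k → TmE (suc m) u₂ (C k) → TmE (suc m) (C k) u₀ → C k ≡ u₁
    only-u₁ k = common (C k)
      where
      common : ∀ v → TmE (suc m) u₂ v → TmE (suc m) v u₀ → v ≡ u₁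
      common (inj₂ q) h₂ h₀ = ⊥-elim (a₂≢a (attached-unique (attachment-position a₂ q h₂)
                                                             (attachment-position a q (TmE-sym (suc m) {inj₂ q} {u₀} h₀))))
      common (inj₁ v) h₂ h₀ = cong inj₁ (enum-common-neighbour m v a₁~a₂ (CycAdj-sym a~a₁) a₂≢a h₂
                                                               (TmE-sym m {v} {enum t m a} h₀))

    outer-bridge-absurd : D 0 ≡ u₀ → D 1 ≡ w 0 → D 2 ≡ w 1 → ⊥
    outer-bridge-absurd D₀ D₁ D₂ =
      bridge-absurd w (_≡ w (1 + (s + s))) D₀ D₁ D₂ inner-nbrs mid-nbrs end-nbrs
        (λ at-2s at-2s+1 → overshoot-absurd w D₀ D₁ at-2s at-2s+1 beyond-nbrs closes)
        (CycAdj⇒enum-adj m a~a₁) (inj₁ (a₁ , refl , trans (toℕ-modN _) pos-s)) only-u₁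

module TowerCycleFree (r : ℕ) where
  open Sizes r
  open Tower r

  base-case : ¬ InducedCycle (TmE 0) L
  base-case cy with pigeonhole t<L (InducedCycle.vertex cy)
    where
    t<L : t < L
    t<L = +-monoʳ-≤ 6 (m≤m+n r s)
  ... | i , j , i<j , e = <⇒≢ i<j (cong toℕ (InducedCycle.vertex-injective cy i j e))

  L<len : ∀ m → L < len t (suc m)
  L<len m = ≤-trans L<t*s (*-monoʳ-≤ t (m≤m*n s (s ^ m) {{m^n≢0 s m}}))
    where
    L<t*s : L < t * s
    L<t*s = subst (L <_) (expand r) (m≤m+n (suc L) (r * r + 5 * r + 1))
      where
      expand : ∀ r → 5 + (2 + r + (2 + r)) + (r * r + 5 * r + 1) ≡ (5 + r) * (2 + r)
      expand = solve-∀

  module _ (m : ℕ) (cy : InducedCycle (TmE (suc m)) L) where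
    open NewLayer r m
    open OnCycle (s≤s (s≤s (s≤s z≤n))) cy

    enter-outer-absurd : ∀ p → ¬ IsRight (C p) → IsRight (C (suc p)) → ⊥
    enter-outer-absurd p ¬out out with C p in C₀ | C (suc p) in C₁
    ... | inj₂ _ | _ = ¬out tt
    ... | inj₁ u | inj₂ q with subst₂ (TmE (suc m)) C₀ C₁ (C-edge p)
    ...   | inj₁ (a , u≡a , q≡as) =
            leave (outer-nbrs (toℕ q) (C (2 + p))
                              (subst (λ v → TmE (suc m) v (C (2 + p))) (trans C₁ (cong inj₂ (sym (modN-toℕ q)))) (C-edge (suc p))))
      where
      open From p
      D₀ : D 0 ≡ inj₁ (enum t m a)
      D₀ = trans (D≡C 0) (trans C₀ (cong inj₁ u≡a))
      D₁ : ∀ δ → D 1 ≡ inj₂ (modN (toℕ a * s + δ * 0))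
      D₁ δ = trans (D≡C 1) (trans C₁ (cong inj₂ (trans (sym (modN-toℕ q))
               (cong modN (trans q≡as (sym (trans (cong (toℕ a * s +_) (*-zeroʳ δ)) (+-identityʳ _))))))))
      leave : _ → ⊥
      leave (inj₁ fwd) = OuterBridge.outer-bridge-absurd r m cy p (inj₁ (refl , refl)) a D₀ (D₁ 1)
                           (trans (D≡C 2) (trans fwd (cong (λ z → inj₂ (modN (z + 1))) q≡as)))
      leave (inj₂ (inj₁ bwd)) = OuterBridge.outer-bridge-absurd r m cy p (inj₂ (refl , refl)) a D₀ (D₁ (N ∸ 1))
                                  (trans (D≡C 2) (trans bwd (cong (λ z → inj₂ (modN z)) (cong₂ _+_ q≡as (sym (*-identityʳ (N ∸ 1)))))))
      leave (inj₂ (inj₂ (i , at-xᵢ , q≡is))) =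
        C-no-repeat₂ p (trans (trans C₀ (cong inj₁ (trans u≡a (cong (enum t m) a≡i)))) (sym at-xᵢ))
        where
        a≡i : a ≡ i
        a≡i = toℕ-injective (*-cancelʳ-≡ _ _ s (trans (sym q≡as) (trans (sym (m<n⇒m%n≡m (toℕ<n q))) q≡is)))

    all-outer-absurd : (∀ k → Σ (Fin N) λ q → C k ≡ inj₂ q) → ⊥
    all-outer-absurd outer = leave (outer-nbrs x (C 1) (subst (λ v → TmE (suc m) v (C 1)) C₀ (C-edge 0)))
      where
      open From 0
      x : ℕ
      x = toℕ (proj₁ (outer 0))
      C₀ : C 0 ≡ inj₂ (modN x)
      C₀ = trans (proj₂ (outer 0)) (cong inj₂ (sym (modN-toℕ _)))
      not-inner : ∀ k {u} → C k ≢ inj₁ u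
      not-inner k e with trans (sym e) (proj₂ (outer k))
      ... | ()
      around : ∀ {δ δ̄} (dir : Direction δ δ̄) → C 1 ≡ inj₂ (modN (x + δ * 1)) → ⊥
      around {δ} dir C₁ = pos-never-returns dir x L z<s (L<len m) (begin
        (x + δ * L) % N          ≡⟨ toℕ-modN _ ⟨
        toℕ (modN (pos x L))     ≡⟨ cong toℕ (inj₂-injective (trans (sym (follow w 0 L confined w₀ C₁ L ≤-refl)) (trans D-wraps w₀))) ⟩
        toℕ (modN (pos x 0))     ≡⟨ toℕ-modN _ ⟩
        (x + δ * 0) % N          ≡⟨ cong (λ z → (x + z) % N) (*-zeroʳ δ) ⟩
        (x + 0) % N              ≡⟨ cong (_% N) (+-identityʳ x) ⟩
        x % N                    ∎)
        where
        open ≡-Reasoning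
        open Walking dir
        w : ℕ → TmV t (suc m)
        w j = inj₂ (modN (pos x j))
        w₀ : D 0 ≡ w 0
        w₀ = trans C₀ (cong (inj₂ ∘ modN) (sym (trans (cong (x +_) (*-zeroʳ δ)) (+-identityʳ x))))
        confined : InteriorConfined w L
        confined (suc j) k _ _ h with walk-nbrs x j (C k) h
        ... | inj₁ back = inj₁ back
        ... | inj₂ (inj₁ on) = inj₂ on
        ... | inj₂ (inj₂ (_ , at-xᵢ , _)) = ⊥-elim (not-inner k at-xᵢ)
      leave : _ → ⊥
      leave (inj₁ fwd) = around (inj₁ (refl , refl)) fwd
      leave (inj₂ (inj₁ bwd)) = around (inj₂ (refl , refl)) (trans bwd (cong (λ z → inj₂ (modN (x + z))) (sym (*-identityʳ (N ∸ 1)))))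
      leave (inj₂ (inj₂ (_ , at-xᵢ , _))) = not-inner 1 at-xᵢ

    open InducedCycle cy using (vertex)

    cycle-free-step : ¬ InducedCycle (TmE m) L → ⊥
    cycle-free-step IH with any? (λ q → isRight? (vertex q))
    ... | no none = IH (pullback cy inj₁ (λ _ _ h → h) (λ _ _ h → h)
                        (λ q → proj₁ (fromLeft (vertex q) (none ∘ (q ,_)))) (λ q → proj₂ (fromLeft (vertex q) _)))
    ... | yes (q₀ , outer) with any? (λ q → isLeft? (vertex q))
    ...   | no none = all-outer-absurd (λ k → fromRight (C k) (none ∘ (idx k ,_)))
    ...   | yes (q₁ , inner) with entry-point IsRight isRight? q₀ q₁ outer (IsLeft⇒¬IsRight (vertex q₁) inner)
    ...     | p , ¬out , out = enter-outer-absurd p ¬out out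

  no-cycle-in-tower : ∀ m → ¬ InducedCycle (TmE m) L
  no-cycle-in-tower zero = base-case
  no-cycle-in-tower (suc m) cy = cycle-free-step m cy (no-cycle-in-tower m)

-- Expansions

module Expansion (r m : ℕ) (d : ExpData (Sizes.t r) (Tm (Sizes.t r) m)) where
  open Sizes r
  open Tower r
  open ExpData d

  VX : Set
  VX = ExpV t (Tm t m) d

  EX : VX → VX → Set
  EX a b = ExpD t (Tm t m) d a b ⊎ ExpD t (Tm t m) d b a

  EX-sym : ∀ {a b} → EX a b → EX b a
  EX-sym = Sum.swap

  K : ℕ
  K = 2 * t ∸ 5

  K≡1+s+s : K ≡ suc (s + s)
  K≡1+s+s = solved r
    where
    solved : ∀ r → r + (5 + (r + 0)) ≡ 3 + (r + (2 + r))
    solved = solve-∀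

  2t∸6≡s+s : 2 * t ∸ 6 ≡ s + s
  2t∸6≡s+s = trans (cong (_∸ 1) (+-suc r (4 + (r + 0)))) (solved r)
    where
    solved : ∀ r → r + (4 + (r + 0)) ≡ 2 + (r + (2 + r))
    solved = solve-∀

  instance
    K-nonZero : NonZero K
    K-nonZero = subst NonZero (sym K≡1+s+s) _

  -- Indices are reduced modulo the number of vertices, so P-index j is position j only for j ≤ 2s.
  P-index : ℕ → Fin K
  P-index j = fromℕ< (m%n<n j K)

  Q-index : ℕ → Fin s
  Q-index j = fromℕ< (m%n<n j s)

  P-at : Fin k → ℕ → VX
  P-at i j = inj₂ (inj₁ (i , P-index j))

  Detour : Set
  Detour = Σ (Fin k) λ i → I i ≡ true

  Q-at : Detour → ℕ → VX
  Q-at ie j = inj₂ (inj₂ (ie , Q-index j))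

  toℕ-P-index : ∀ {j} → j ≤ s + s → toℕ (P-index j) ≡ j
  toℕ-P-index {j} j≤2s = trans (toℕ-fromℕ< _) (m<n⇒m%n≡m (subst (j <_) (sym K≡1+s+s) (s≤s j≤2s)))

  P-index-toℕ : ∀ j → P-index (toℕ j) ≡ j
  P-index-toℕ j = toℕ-injective (trans (toℕ-fromℕ< _) (m<n⇒m%n≡m (toℕ<n j)))

  toℕ≤2s : ∀ (j : Fin K) → toℕ j ≤ s + s
  toℕ≤2s j = ≤-pred (subst (toℕ j <_) K≡1+s+s (toℕ<n j))

  toℕ-Q-index : ∀ {j} → j ≤ suc r → toℕ (Q-index j) ≡ j
  toℕ-Q-index j≤ = trans (toℕ-fromℕ< _) (m<n⇒m%n≡m (s≤s j≤))

  Q-index-toℕ : ∀ j → Q-index (toℕ j) ≡ j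
  Q-index-toℕ j = toℕ-injective (trans (toℕ-fromℕ< _) (m<n⇒m%n≡m (toℕ<n j)))

  IsP IsQ : VX → Set
  IsP = Sum.[ (λ _ → ⊥) , IsLeft ]
  IsQ = Sum.[ (λ _ → ⊥) , IsRight ]

  isP? : ∀ v → Dec (IsP v)
  isP? (inj₁ _) = no λ ()
  isP? (inj₂ v) = isLeft? v

  isQ? : ∀ v → Dec (IsQ v)
  isQ? (inj₁ _) = no λ ()
  isQ? (inj₂ v) = isRight? v

  data PNbr (P : ℕ → VX) (Qok : Set) (Q : Qok → ℕ → VX) (u⁻ u u⁺ : VX) (j : ℕ) (v : VX) : Set where
    next    : v ≡ P (suc j) → suc j ≤ s + s → PNbr P Qok Q u⁻ u u⁺ j v
    prev    : ∀ j' → j ≡ suc j' → v ≡ P j' → PNbr P Qok Q u⁻ u u⁺ j v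
    at-u⁻   : v ≡ u⁻ → j ≡ 0 → PNbr P Qok Q u⁻ u u⁺ j v
    at-u    : v ≡ u → j ≡ s → PNbr P Qok Q u⁻ u u⁺ j v
    at-u⁺   : v ≡ u⁺ → j ≡ s + s → PNbr P Qok Q u⁻ u u⁺ j v
    at-Q₀   : (e : Qok) → v ≡ Q e 0 → j ≡ suc r → PNbr P Qok Q u⁻ u u⁺ j v
    at-Qₑ   : (e : Qok) → v ≡ Q e (suc r) → j ≡ suc s → PNbr P Qok Q u⁻ u u⁺ j v

  data QNbr (P Q : ℕ → VX) (j : ℕ) (v : VX) : Set where
    next    : v ≡ Q (suc j) → suc j ≤ suc r → QNbr P Q j v
    prev    : ∀ j' → j ≡ suc j' → v ≡ Q j' → QNbr P Q j v
    at-v⁻   : v ≡ P (suc r) → j ≡ 0 → QNbr P Q j v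
    at-v⁺   : v ≡ P (suc s) → j ≡ suc r → QNbr P Q j v

  -- P_i with x_i^-, x_i, x_i^+ (as u⁻ u u⁺) and Q_i, described by their neighbourhoods only, so that
  -- the same description covers P_i read backwards.
  record Gadget : Set₁ where
    field
      P              : ℕ → VX
      Qok            : Set
      Q              : Qok → ℕ → VX
      u⁻ u u⁺        : VX
      P-nbrs         : ∀ j v → j ≤ s + s → EX (P j) v → PNbr P Qok Q u⁻ u u⁺ j v
      Q-nbrs         : ∀ e j v → j ≤ suc r → EX (Q e j) v → QNbr P (Q e) j v
      P-edge         : ∀ j → j < s + s → EX (P j) (P (suc j))
      u⁻~u           : EX u⁻ u
      u~u⁺           : EX u u⁺
      u~mid          : EX u (P s)
      only-u         : ∀ v → ¬ IsQ v → EX u⁺ v → EX v u⁻ → v ≡ u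
      u⁺≁P           : ∀ j → j < s + s → ¬ EX u⁺ (P j)
      u⁻≁P           : ∀ j → 0 < j → j ≤ s + s → ¬ EX u⁻ (P j)
      u⁺≁u⁻          : ¬ EX u⁺ u⁻
      Q-IsQ          : ∀ e j → IsQ (Q e j)
      Qok-irrelevant : ∀ (e e' : Qok) → e ≡ e'

  M : ℕ
  M = len t m

  record Positions (i : Fin k) : Set where
    field
      a⁻ a a⁺ : Fin M
      xm≡a⁻   : xm i ≡ enum t m a⁻
      x≡a     : x i ≡ enum t m a
      xp≡a⁺   : xp i ≡ enum t m a⁺
      a~a⁻    : CycAdj M a a⁻
      a~a⁺    : CycAdj M a a⁺
      a⁻≢a⁺   : a⁻ ≢ a⁺

  positions : ∀ i → Positions i
  positions i = record
    { a⁻ = proj₁ at⁻ ; a = proj₁ at ; a⁺ = proj₁ at⁺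
    ; xm≡a⁻ = proj₂ at⁻ ; x≡a = proj₂ at ; xp≡a⁺ = proj₂ at⁺
    ; a~a⁻ = CycAdj-sym (enum-adj⇒CycAdj m (subst₂ (TmE m) (proj₂ at⁻) (proj₂ at) (xm~x i)))
    ; a~a⁺ = CycAdj-sym (enum-adj⇒CycAdj m (subst₂ (TmE m) (proj₂ at⁺) (proj₂ at) (xp~x i)))
    ; a⁻≢a⁺ = λ e → xm≢xp i (trans (proj₂ at⁻) (trans (cong (enum t m) e) (sym (proj₂ at⁺))))
    }
    where
    at⁻ = boundary-enum m (xm i) (xm∈B i)
    at = boundary-enum m (x i) (x∈B i)
    at⁺ = boundary-enum m (xp i) (xp∈B i)

  x-only-common : ∀ i v → TmE m (xp i) v → TmE m v (xm i) → v ≡ x i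
  x-only-common i v xp~v v~xm = trans
    (enum-common-neighbour m v a~a⁺ a~a⁻ (a⁻≢a⁺ ∘ sym) (subst (λ z → TmE m z v) xp≡a⁺ xp~v)
                           (TmE-sym m {v} (subst (TmE m v) xm≡a⁻ v~xm)))
    (sym x≡a)
    where open Positions (positions i)

  xp≁xm : ∀ i → ¬ TmE m (xp i) (xm i)
  xp≁xm i xp~xm = CyclicOrder.CycAdj-triangle-free M {{len-nonZero m}} (len≥5 m) a~a⁻ a~a⁺ a⁻≢a⁺
                    (CycAdj-sym (enum-adj⇒CycAdj m (subst₂ (TmE m) xp≡a⁺ xm≡a⁻ xp~xm)))
    where open Positions (positions i)

  x-not-self-adjacent : ∀ i {v} → TmE m v (x i) → v ≢ x i
  x-not-self-adjacent i v~x v≡x = x-stable i i (subst (λ z → TmE m z (x i)) v≡x v~x)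

  inner-edge : ∀ {a b} → EX (inj₁ a) (inj₁ b) → TmE m a b
  inner-edge = Sum.[ (λ h → h) , TmE-sym m ]

  private
    0≢s : 0 ≢ s
    0≢s ()
    0≢s+s : 0 ≢ s + s
    0≢s+s ()
    s≢s+s : s ≢ s + s
    s≢s+s = <⇒≢ s<s+s

  P-not-common : ∀ i {i' j} → ExpD t (Tm t m) d (inj₁ (xp i)) (inj₂ (inj₁ (i' , j))) →
                              ¬ ExpD t (Tm t m) d (inj₁ (xm i)) (inj₂ (inj₁ (i' , j)))
  P-not-common i (inj₁ (e₁ , _)) (inj₁ (e₂ , _)) = xm≢xp i (trans e₂ (sym e₁))
  P-not-common i (inj₂ (inj₁ (e₁ , _))) (inj₂ (inj₁ (e₂ , _))) = xm≢xp i (trans e₂ (sym e₁))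
  P-not-common i (inj₂ (inj₂ (e₁ , _))) (inj₂ (inj₂ (e₂ , _))) = xm≢xp i (trans e₂ (sym e₁))
  P-not-common i (inj₁ (_ , f₁)) (inj₂ (inj₁ (_ , f₂))) = 0≢s (trans (sym f₁) f₂)
  P-not-common i (inj₁ (_ , f₁)) (inj₂ (inj₂ (_ , f₂))) = 0≢s+s (trans (sym f₁) (trans f₂ 2t∸6≡s+s))
  P-not-common i (inj₂ (inj₁ (_ , f₁))) (inj₁ (_ , f₂)) = 0≢s (trans (sym f₂) f₁)
  P-not-common i (inj₂ (inj₁ (_ , f₁))) (inj₂ (inj₂ (_ , f₂))) = s≢s+s (trans (sym f₁) (trans f₂ 2t∸6≡s+s))
  P-not-common i (inj₂ (inj₂ (_ , f₁))) (inj₁ (_ , f₂)) = 0≢s+s (trans (sym f₂) (trans f₁ 2t∸6≡s+s))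
  P-not-common i (inj₂ (inj₂ (_ , f₁))) (inj₂ (inj₁ (_ , f₂))) = s≢s+s (trans (sym f₂) (trans f₁ 2t∸6≡s+s))

  Pᵢ-nbrs : ∀ i j v → j ≤ s + s → EX (P-at i j) v →
           PNbr (P-at i) (I i ≡ true) (Q-at ∘ (i ,_)) (inj₁ (xm i)) (inj₁ (x i)) (inj₁ (xp i)) j v
  Pᵢ-nbrs i j (inj₁ a) j≤ (inj₂ (inj₁ (a≡ , f))) = at-u⁻ (cong inj₁ a≡) (trans (sym (toℕ-P-index j≤)) f)
  Pᵢ-nbrs i j (inj₁ a) j≤ (inj₂ (inj₂ (inj₁ (a≡ , f)))) = at-u (cong inj₁ a≡) (trans (sym (toℕ-P-index j≤)) f)
  Pᵢ-nbrs i j (inj₁ a) j≤ (inj₂ (inj₂ (inj₂ (a≡ , f)))) =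
    at-u⁺ (cong inj₁ a≡) (trans (sym (toℕ-P-index j≤)) (trans f 2t∸6≡s+s))
  Pᵢ-nbrs i j (inj₂ (inj₁ (.i , j'))) j≤ (inj₁ (refl , f)) =
    next (cong (λ z → inj₂ (inj₁ (i , z))) (trans (sym (P-index-toℕ j')) (cong P-index j'≡)))
         (subst (_≤ s + s) j'≡ (toℕ≤2s j'))
    where
    j'≡ : toℕ j' ≡ suc j
    j'≡ = trans f (cong suc (toℕ-P-index j≤))
  Pᵢ-nbrs i j (inj₂ (inj₁ (.i , j'))) j≤ (inj₂ (refl , f)) =
    prev (toℕ j') (trans (sym (toℕ-P-index j≤)) f) (cong (λ z → inj₂ (inj₁ (i , z))) (sym (P-index-toℕ j')))
  Pᵢ-nbrs i j (inj₂ (inj₂ ((.i , e) , j'))) j≤ (inj₁ (refl , inj₁ (f , f'))) =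
    at-Q₀ e (cong (λ z → inj₂ (inj₂ ((i , e) , z))) (toℕ-injective (trans f' (sym (toℕ-Q-index z≤n)))))
            (trans (sym (toℕ-P-index j≤)) f)
  Pᵢ-nbrs i j (inj₂ (inj₂ ((.i , e) , j'))) j≤ (inj₁ (refl , inj₂ (f , f'))) =
    at-Qₑ e (cong (λ z → inj₂ (inj₂ ((i , e) , z))) (toℕ-injective (trans f' (sym (toℕ-Q-index ≤-refl)))))
            (trans (sym (toℕ-P-index j≤)) f)

  I-irrelevant : ∀ {i} (e e' : I i ≡ true) → e ≡ e'
  I-irrelevant = Decidable⇒UIP.≡-irrelevant Bool._≟_

  Qᵢ-nbrs : ∀ i e j v → j ≤ suc r → EX (Q-at (i , e) j) v → QNbr (P-at i) (Q-at (i , e)) j v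
  Qᵢ-nbrs i e j (inj₂ (inj₂ ((.i , e') , j'))) j≤ (inj₁ (refl , f)) with I-irrelevant e e'
  ... | refl = next (cong (λ z → inj₂ (inj₂ ((i , e) , z))) (trans (sym (Q-index-toℕ j')) (cong Q-index j'≡)))
                    (≤-pred (subst (_< s) j'≡ (toℕ<n j')))
    where
    j'≡ : toℕ j' ≡ suc j
    j'≡ = trans f (cong suc (toℕ-Q-index j≤))
  Qᵢ-nbrs i e j (inj₂ (inj₂ ((.i , e') , j'))) j≤ (inj₂ (refl , f)) with I-irrelevant e e'
  ... | refl = prev (toℕ j') (trans (sym (toℕ-Q-index j≤)) f) (cong (λ z → inj₂ (inj₂ ((i , e) , z))) (sym (Q-index-toℕ j')))
  Qᵢ-nbrs i e j (inj₂ (inj₁ (.i , j'))) j≤ (inj₂ (refl , inj₁ (f , f'))) =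
    at-v⁻ (cong (λ z → inj₂ (inj₁ (i , z))) (trans (sym (P-index-toℕ j')) (cong P-index f))) (trans (sym (toℕ-Q-index j≤)) f')
  Qᵢ-nbrs i e j (inj₂ (inj₁ (.i , j'))) j≤ (inj₂ (refl , inj₂ (f , f'))) =
    at-v⁺ (cong (λ z → inj₂ (inj₁ (i , z))) (trans (sym (P-index-toℕ j')) (cong P-index f))) (trans (sym (toℕ-Q-index j≤)) f')

  gadget : Fin k → Gadget
  gadget i = record
    { P = P-at i ; Qok = I i ≡ true ; Q = Q-at ∘ (i ,_)
    ; u⁻ = inj₁ (xm i) ; u = inj₁ (x i) ; u⁺ = inj₁ (xp i)
    ; P-nbrs = Pᵢ-nbrs i ; Q-nbrs = Qᵢ-nbrs i
    ; P-edge = λ j j<2s → inj₁ (refl , trans (toℕ-P-index j<2s) (cong suc (sym (toℕ-P-index (<⇒≤ j<2s)))))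
    ; u⁻~u = inj₁ (xm~x i) ; u~u⁺ = inj₂ (xp~x i)
    ; u~mid = inj₁ (inj₂ (inj₁ (refl , toℕ-P-index (m≤m+n s s))))
    ; only-u = only-x ; u⁺≁P = xp≁P ; u⁻≁P = xm≁P ; u⁺≁u⁻ = xp≁xm i ∘ inner-edge
    ; Q-IsQ = λ _ _ → tt ; Qok-irrelevant = I-irrelevant
    }
    where
    only-x : ∀ v → ¬ IsQ v → EX (inj₁ (xp i)) v → EX v (inj₁ (xm i)) → v ≡ inj₁ (x i)
    only-x (inj₁ v) _ xp~v v~xm = cong inj₁ (x-only-common i v (inner-edge xp~v) (inner-edge v~xm))
    only-x (inj₂ (inj₁ _)) _ (inj₁ xp~v) (inj₂ xm~v) = ⊥-elim (P-not-common i xp~v xm~v)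
    only-x (inj₂ (inj₂ _)) ¬Q _ _ = ⊥-elim (¬Q tt)
    xp≁P : ∀ j → j < s + s → ¬ EX (inj₁ (xp i)) (P-at i j)
    xp≁P j _ (inj₁ (inj₁ (xp≡xm , _))) = xm≢xp i (sym xp≡xm)
    xp≁P j _ (inj₁ (inj₂ (inj₁ (xp≡x , _)))) = x-not-self-adjacent i (xp~x i) xp≡x
    xp≁P j j<2s (inj₁ (inj₂ (inj₂ (_ , f)))) = <-irrefl (trans (sym (toℕ-P-index (<⇒≤ j<2s))) (trans f 2t∸6≡s+s)) j<2s
    xm≁P : ∀ j → 0 < j → j ≤ s + s → ¬ EX (inj₁ (xm i)) (P-at i j)
    xm≁P j 0<j j≤ (inj₁ (inj₁ (_ , f))) = <⇒≢ 0<j (sym (trans (sym (toℕ-P-index j≤)) f))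
    xm≁P j _ _ (inj₁ (inj₂ (inj₁ (xm≡x , _)))) = x-not-self-adjacent i (xm~x i) xm≡x
    xm≁P j _ _ (inj₁ (inj₂ (inj₂ (xm≡xp , _)))) = xm≢xp i xm≡xp

  private
    flip-index : ∀ {n j c} → j ≤ n → n ∸ j ≡ c → j ≡ n ∸ c
    flip-index {n} j≤n e = trans (sym (m∸[m∸n]≡n j≤n)) (cong (n ∸_) e)

  module Reversed (G : Gadget) where
    open Gadget G

    P′ : ℕ → VX
    P′ j = P (s + s ∸ j)

    Q′ : Qok → ℕ → VX
    Q′ q j = Q q (suc r ∸ j)

    P′-nbrs : ∀ j v → j ≤ s + s → EX (P′ j) v → PNbr P′ Qok Q′ u⁺ u u⁻ j v
    P′-nbrs j v j≤ h with P-nbrs (s + s ∸ j) v (m∸n≤m _ j) h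
    P′-nbrs zero v j≤ h | next _ 2s+1≤2s = ⊥-elim (<-irrefl refl 2s+1≤2s)
    P′-nbrs (suc j) v j≤ h | next on _ = prev j refl (trans on (cong P (sym (+-∸-assoc 1 j≤))))
    ... | prev j' e back = next (trans back (cong P (trans (sym (cong pred e)) (pred[m∸n]≡m∸[1+n] (s + s) j))))
                                (m∸n≢0⇒n<m (λ z → 0≢1+n (trans (sym z) e)))
    ... | at-u⁻ on e = at-u⁺ on (flip-index j≤ e)
    ... | at-u on e = at-u on (trans (flip-index j≤ e) s+s∸s≡s)
    ... | at-u⁺ on e = at-u⁻ on (trans (flip-index j≤ e) (n∸n≡0 (s + s)))
    ... | at-Q₀ q on e = at-Qₑ q (trans on (cong (Q q) (sym (n∸n≡0 (suc r))))) (trans (flip-index j≤ e) s+s∸suc[r]≡suc[s])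
    ... | at-Qₑ q on e = at-Q₀ q on (trans (flip-index j≤ e) s+s∸suc[s]≡suc[r])

    Q′-nbrs : ∀ q j v → j ≤ suc r → EX (Q′ q j) v → QNbr P′ (Q′ q) j v
    Q′-nbrs q j v j≤ h with Q-nbrs q (suc r ∸ j) v (m∸n≤m _ j) h
    Q′-nbrs q zero v j≤ h | next _ r+2≤r+1 = ⊥-elim (<-irrefl refl r+2≤r+1)
    Q′-nbrs q (suc j) v j≤ h | next on _ = prev j refl (trans on (cong (Q q) (sym (+-∸-assoc 1 j≤))))
    ... | prev j' e back = next (trans back (cong (Q q) (trans (sym (cong pred e)) (pred[m∸n]≡m∸[1+n] (suc r) j))))
                                (m∸n≢0⇒n<m (λ z → 0≢1+n (trans (sym z) e)))
    ... | at-v⁻ on e = at-v⁺ (trans on (cong P (sym s+s∸suc[s]≡suc[r]))) (flip-index j≤ e)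
    ... | at-v⁺ on e = at-v⁻ (trans on (cong P (sym s+s∸suc[r]≡suc[s]))) (trans (flip-index j≤ e) (n∸n≡0 (suc r)))

    P′-edge : ∀ j → j < s + s → EX (P′ j) (P′ (suc j))
    P′-edge j j<2s = EX-sym {P (s + s ∸ suc j)} {P (s + s ∸ j)} (subst (λ z → EX (P (s + s ∸ suc j)) (P z)) (sym (+-∸-assoc 1 j<2s))
                               (P-edge (s + s ∸ suc j) (∸-monoʳ-< z<s j<2s)))

    reversed : Gadget
    reversed = record
      { P = P′ ; Qok = Qok ; Q = Q′ ; u⁻ = u⁺ ; u = u ; u⁺ = u⁻
      ; P-nbrs = P′-nbrs ; Q-nbrs = Q′-nbrs ; P-edge = P′-edge
      ; u⁻~u = EX-sym {u} {u⁺} u~u⁺ ; u~u⁺ = EX-sym {u⁻} {u} u⁻~u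
      ; u~mid = subst (λ z → EX u (P z)) (sym s+s∸s≡s) u~mid
      ; only-u = λ v ¬Q u⁻~v v~u⁺ → only-u v ¬Q (EX-sym {v} {u⁺} v~u⁺) (EX-sym {u⁻} {v} u⁻~v)
      ; u⁺≁P = λ j j<2s → u⁻≁P (s + s ∸ j) (m<n⇒0<n∸m j<2s) (m∸n≤m _ j)
      ; u⁻≁P = λ j 0<j j≤2s → u⁺≁P (s + s ∸ j) (∸-monoʳ-< 0<j j≤2s)
      ; u⁺≁u⁻ = u⁺≁u⁻ ∘ EX-sym {u⁻} {u⁺}
      ; Q-IsQ = λ q j → Q-IsQ q (suc r ∸ j) ; Qok-irrelevant = Qok-irrelevant
      }

  open Reversed public using (reversed)

module ExpansionCycle (r m : ℕ) (d : ExpData (Sizes.t r) (Tm (Sizes.t r) m))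
                      (cy : InducedCycle (Expansion.EX r m d) (Sizes.L r)) where
  open Sizes r
  open Tower r
  open Expansion r m d
  open ExpData d
  open OnCycle (s≤s (s≤s (s≤s z≤n))) cy

  module Around (G : Gadget) where
    open Gadget G

    module _ (noQ : ∀ n → ¬ IsQ (C n)) where

      not-Q : ∀ n {q j} → C n ≢ Q q j
      not-Q n {q} {j} on = noQ n (subst IsQ (sym on) (Q-IsQ q j))

      inner-nbrs : ∀ j n → 0 < j → j < s + s → j ≢ s → EX (P j) (C n) → C n ≡ P (pred j) ⊎ C n ≡ P (suc j)
      inner-nbrs j n 0<j j<2s j≢s h with P-nbrs j (C n) (<⇒≤ j<2s) h
      ... | next on _ = inj₂ on
      ... | prev j' refl back = inj₁ back
      ... | at-u⁻ _ j≡0 = ⊥-elim (>⇒≢ 0<j j≡0)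
      ... | at-u _ j≡s = ⊥-elim (j≢s j≡s)
      ... | at-u⁺ _ j≡2s = ⊥-elim (<⇒≢ j<2s j≡2s)
      ... | at-Q₀ _ on _ = ⊥-elim (not-Q n on)
      ... | at-Qₑ _ on _ = ⊥-elim (not-Q n on)

      mid-nbrs : ∀ n → EX (P s) (C n) → C n ≡ P (pred s) ⊎ C n ≡ u ⊎ C n ≡ P (suc s)
      mid-nbrs n h with P-nbrs s (C n) (m≤m+n s s) h
      ... | next on _ = inj₂ (inj₂ on)
      ... | prev j' refl back = inj₁ back
      ... | at-u on _ = inj₂ (inj₁ on)
      ... | at-u⁺ _ s≡2s = ⊥-elim (<⇒≢ s<s+s s≡2s)
      ... | at-Q₀ _ on _ = ⊥-elim (not-Q n on)
      ... | at-Qₑ _ on _ = ⊥-elim (not-Q n on)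

      end-nbrs : ∀ n → EX (P (s + s)) (C n) → C n ≡ P (pred (s + s)) ⊎ C n ≡ u⁺ ⊎ ⊥
      end-nbrs n h with P-nbrs (s + s) (C n) ≤-refl h
      ... | next _ 2s+1≤2s = ⊥-elim (<-irrefl refl 2s+1≤2s)
      ... | prev j' refl back = inj₁ back
      ... | at-u⁺ on _ = inj₂ (inj₁ on)
      ... | at-u _ 2s≡s = ⊥-elim (>⇒≢ s<s+s 2s≡s)
      ... | at-Q₀ _ on _ = ⊥-elim (not-Q n on)
      ... | at-Qₑ _ on _ = ⊥-elim (not-Q n on)

      second-half-confined : InteriorConfined (λ j → P (s + j)) s
      second-half-confined (suc j) n _ j<s h with P-nbrs (s + suc j) (C n) (<⇒≤ (+-monoʳ-< s j<s)) h
      ... | next on _ = inj₂ (trans on (cong P (sym (+-suc s (suc j)))))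
      ... | prev j' e back = inj₁ (trans back (cong P (suc-injective (trans (sym e) (+-suc s j)))))
      ... | at-u _ e = ⊥-elim (>⇒≢ (m<m+n s z<s) e)
      ... | at-u⁺ _ e = ⊥-elim (<⇒≢ (+-monoʳ-< s j<s) e)
      ... | at-Q₀ _ on _ = ⊥-elim (not-Q n on)
      ... | at-Qₑ _ on _ = ⊥-elim (not-Q n on)

      end-nbrs-from-middle : ∀ n → EX (P (s + s)) (C n) → C n ≡ P (s + suc r) ⊎ C n ≡ u⁺ ⊎ ⊥
      end-nbrs-from-middle n h with end-nbrs n h
      ... | inj₁ back = inj₁ (trans back (cong P (suc-injective s+s≡suc[s+suc[r]])))
      ... | inj₂ other = inj₂ other

    module _ (q : Qok) where

      as-Q : ∀ {n q' j} → C n ≡ Q q' j → C n ≡ Q q j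
      as-Q {q' = q'} on = trans on (cong (λ z → Q z _) (Qok-irrelevant q' q))

      Q₀-nbrs : ∀ n → EX (Q q 0) (C n) → C n ≡ P (suc r) ⊎ C n ≡ Q q 1
      Q₀-nbrs n h with Q-nbrs q 0 (C n) z≤n h
      ... | next on _ = inj₂ on
      ... | at-v⁻ on _ = inj₁ on

      Q-inner : InteriorConfined (Q q) (suc r)
      Q-inner j n 0<j j<r+1 h with Q-nbrs q j (C n) (<⇒≤ j<r+1) h
      ... | next on _ = inj₂ on
      ... | prev j' refl back = inj₁ back
      ... | at-v⁻ _ j≡0 = ⊥-elim (>⇒≢ 0<j j≡0)
      ... | at-v⁺ _ j≡r+1 = ⊥-elim (<⇒≢ j<r+1 j≡r+1)

      Qₑ-nbrs : ∀ n → EX (Q q (suc r)) (C n) → C n ≡ Q q r ⊎ C n ≡ P (suc s)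
      Qₑ-nbrs n h with Q-nbrs q (suc r) (C n) ≤-refl h
      ... | next _ r+2≤r+1 = ⊥-elim (<-irrefl refl r+2≤r+1)
      ... | prev j' refl back = inj₁ back
      ... | at-v⁺ on _ = inj₂ on

      v⁺-nbrs : ∀ n → EX (P (suc s)) (C n) → C n ≡ P s ⊎ C n ≡ P (2 + s) ⊎ C n ≡ Q q (suc r)
      v⁺-nbrs n h with P-nbrs (suc s) (C n) (<⇒≤ suc[s]<s+s) h
      ... | next on _ = inj₂ (inj₁ on)
      ... | prev j' refl back = inj₁ back
      ... | at-u⁺ _ e = ⊥-elim (<⇒≢ suc[s]<s+s e)
      ... | at-Qₑ _ on _ = inj₂ (inj₂ (as-Q {n} on))

      upper-nbrs : ∀ j n → suc s < j → j < s + s → EX (P j) (C n) → C n ≡ P (pred j) ⊎ C n ≡ P (suc j)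
      upper-nbrs j n s+1<j j<2s h with P-nbrs j (C n) (<⇒≤ j<2s) h
      ... | next on _ = inj₂ on
      ... | prev j' refl back = inj₁ back
      ... | at-u⁻ _ e = ⊥-elim (>⇒≢ (≤-trans (s≤s z≤n) s+1<j) e)
      ... | at-u _ e = ⊥-elim (>⇒≢ (<-trans (n<1+n s) s+1<j) e)
      ... | at-u⁺ _ e = ⊥-elim (<⇒≢ j<2s e)
      ... | at-Q₀ _ _ e = ⊥-elim (>⇒≢ (<-trans (<-trans (n<1+n (suc r)) (n<1+n s)) s+1<j) e)
      ... | at-Qₑ _ _ e = ⊥-elim (>⇒≢ s+1<j e)

      Pₑ-nbrs : ∀ n → EX (P (s + s)) (C n) → C n ≡ P (pred (s + s)) ⊎ C n ≡ u⁺
      Pₑ-nbrs n h with P-nbrs (s + s) (C n) ≤-refl h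
      ... | next _ 2s+1≤2s = ⊥-elim (<-irrefl refl 2s+1≤2s)
      ... | prev j' refl back = inj₁ back
      ... | at-u⁺ on _ = inj₂ on
      ... | at-u _ e = ⊥-elim (>⇒≢ s<s+s e)
      ... | at-Q₀ _ _ e = ⊥-elim (>⇒≢ suc[r]<s+s e)
      ... | at-Qₑ _ _ e = ⊥-elim (>⇒≢ suc[s]<s+s e)

      v⁻-nbrs : ∀ n → EX (P (suc r)) (C n) → C n ≡ P r ⊎ C n ≡ P s ⊎ C n ≡ Q q 0
      v⁻-nbrs n h with P-nbrs (suc r) (C n) (<⇒≤ suc[r]<s+s) h
      ... | next on _ = inj₂ (inj₁ on)
      ... | prev j' refl back = inj₁ back
      ... | at-u⁺ _ e = ⊥-elim (<⇒≢ suc[r]<s+s e)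
      ... | at-Q₀ _ on _ = inj₂ (inj₂ (as-Q {n} on))

      Pᵣ-nbrs : ∀ n → EX (P r) (C n) → C n ≡ P (pred r) ⊎ C n ≡ P (suc r) ⊎ C n ≡ u⁻
      Pᵣ-nbrs n h with P-nbrs r (C n) (<⇒≤ r<s+s) h
      ... | next on _ = inj₂ (inj₁ on)
      ... | prev j' e back = inj₁ (trans back (cong P (sym (cong pred e))))
      ... | at-u⁻ on _ = inj₂ (inj₂ on)
      ... | at-u _ e = ⊥-elim (<⇒≢ (<-trans (n<1+n r) (n<1+n (suc r))) e)
      ... | at-u⁺ _ e = ⊥-elim (<⇒≢ r<s+s e)
      ... | at-Qₑ _ _ e = ⊥-elim (<⇒≢ (<-trans (n<1+n r) (<-trans (n<1+n (suc r)) (n<1+n s))) e)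

    module Entering (p : ℕ) where
      open From p
      open Segments r cy p

      enter-at-end-absurd : (∀ n → ¬ IsQ (C n)) → D 0 ≡ u⁻ → D 1 ≡ P 0 → ⊥
      enter-at-end-absurd noQ D₀ D₁ =
        bridge-absurd P (λ _ → ⊥) D₀ D₁ D₂ (inner-nbrs noQ) (mid-nbrs noQ) (end-nbrs noQ) (λ _ ()) u⁻~u u~mid
                      (λ n → only-u (C n) (noQ n))
        where
        D₂ : D 2 ≡ P 1
        D₂ with P-nbrs 0 (D 2) z≤n (subst (λ v → EX v (D 2)) D₁ (D-edge 1))
        ... | next on _ = on
        ... | at-u⁻ back _ = ⊥-elim (D-distinct {0} {2} z<s (s<s (s<s z<s)) (trans D₀ (sym back)))
        ... | at-Q₀ _ on _ = ⊥-elim (not-Q noQ (2 + p) (trans (sym (D≡C 2)) on))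
        ... | at-Qₑ _ on _ = ⊥-elim (not-Q noQ (2 + p) (trans (sym (D≡C 2)) on))

      enter-at-middle-absurd : (∀ n → ¬ IsQ (C n)) → D 0 ≡ u → D 1 ≡ P s → D 2 ≡ P (suc s) → ⊥
      enter-at-middle-absurd noQ D₀ D₁ D₂ =
        runs-past-midpoint (λ j → P (s + j)) (λ _ → ⊥) D₀ (trans D₁ (cong P (sym (+-identityʳ s))))
                           (trans D₂ (cong P (+-comm 1 s))) (second-half-confined noQ) (end-nbrs-from-middle noQ) u~u⁺

      enter-detour-absurd : ∀ q → D 0 ≡ P (suc r) → D 1 ≡ Q q 0 → ⊥
      enter-detour-absurd q D₀ D₁ =
        Detour.cannot-close P (Q q) D₀ D₁ (Q₀-nbrs q) (Q-inner q) (Qₑ-nbrs q) (v⁺-nbrs q) (upper-nbrs q) (Pₑ-nbrs q)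
                            (v⁻-nbrs q) (Pᵣ-nbrs q) (P-edge (suc r) suc[r]<s+s) (P-edge s s<s+s) u⁺≁P u⁺≁u⁻

  enter-P-absurd : (∀ n → ¬ IsQ (C n)) → ∀ p → ¬ IsP (C p) → IsP (C (suc p)) → ⊥
  enter-P-absurd noQ p ¬P P with C p in C₀ | C (suc p) in C₁
  ... | inj₂ (inj₁ _) | _ = ¬P tt
  ... | inj₂ (inj₂ _) | _ = noQ p (subst IsQ (sym C₀) tt)
  ... | inj₁ y | inj₂ (inj₁ (i , j)) = from-inner (subst₂ EX C₀ C₁ (C-edge p))
    where
    open From p
    D₀ : ∀ {a} → y ≡ a → D 0 ≡ inj₁ a
    D₀ y≡a = trans (D≡C 0) (trans C₀ (cong inj₁ y≡a))
    D₁ : ∀ {n} → toℕ j ≡ n → D 1 ≡ P-at i n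
    D₁ j≡n = trans (D≡C 1) (trans C₁ (cong (λ z → inj₂ (inj₁ (i , z))) (trans (sym (P-index-toℕ j)) (cong P-index j≡n))))
    from-inner : EX (inj₁ y) (inj₂ (inj₁ (i , j))) → ⊥
    from-inner (inj₁ (inj₁ (y≡xm , j≡0))) =
      Around.Entering.enter-at-end-absurd (gadget i) p noQ (D₀ y≡xm) (D₁ j≡0)
    from-inner (inj₁ (inj₂ (inj₂ (y≡xp , j≡2s)))) =
      Around.Entering.enter-at-end-absurd (reversed (gadget i)) p noQ (D₀ y≡xp) (D₁ (trans j≡2s 2t∸6≡s+s))
    from-inner (inj₁ (inj₂ (inj₁ (y≡x , j≡s)))) =
      middle (Pᵢ-nbrs i s (D 2) (m≤m+n s s) (subst (λ v → EX v (D 2)) (D₁ j≡s) (D-edge 1)))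
      where
      middle : PNbr (P-at i) (I i ≡ true) (Q-at ∘ (i ,_)) (inj₁ (xm i)) (inj₁ (x i)) (inj₁ (xp i)) s (D 2) → ⊥
      middle (next on _) = Around.Entering.enter-at-middle-absurd (gadget i) p noQ (D₀ y≡x) (D₁ j≡s) on
      middle (prev j' refl back) =
        Around.Entering.enter-at-middle-absurd (reversed (gadget i)) p noQ (D₀ y≡x)
          (trans (D₁ j≡s) (cong (P-at i) (sym s+s∸s≡s))) (trans back (cong (P-at i) (sym s+s∸suc[s]≡suc[r])))
      middle (at-u back _) = D-distinct {0} {2} z<s (s<s (s<s z<s)) (trans (D₀ y≡x) (sym back))
      middle (at-u⁺ _ s≡2s) = <⇒≢ s<s+s s≡2s
      middle (at-Q₀ _ on _) = noQ (2 + p) (subst IsQ (trans (sym on) (D≡C 2)) tt)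
      middle (at-Qₑ _ on _) = noQ (2 + p) (subst IsQ (trans (sym on) (D≡C 2)) tt)

  enter-Q-absurd : ∀ p → ¬ IsQ (C p) → IsQ (C (suc p)) → ⊥
  enter-Q-absurd p ¬Q Q with C (suc p) in C₁
  ... | inj₂ (inj₂ ((i , e) , j)) = from-outside (Qᵢ-nbrs i e (toℕ j) (D 0) (≤-pred (toℕ<n j))
                                      (EX-sym {D 0} {Q-at (i , e) (toℕ j)} (subst (EX (D 0)) (D₁ refl) (D-edge 0))))
    where
    open From p
    D₁ : ∀ {n} → toℕ j ≡ n → D 1 ≡ Q-at (i , e) n
    D₁ j≡n = trans (D≡C 1) (trans C₁ (cong (λ z → inj₂ (inj₂ ((i , e) , z))) (trans (sym (Q-index-toℕ j)) (cong Q-index j≡n))))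
    not-Q : ∀ {j'} → D 0 ≢ Q-at (i , e) j'
    not-Q on = ¬Q (subst IsQ (trans (sym on) (D≡C 0)) tt)
    from-outside : QNbr (P-at i) (Q-at (i , e)) (toℕ j) (D 0) → ⊥
    from-outside (next on _) = not-Q {suc (toℕ j)} on
    from-outside (prev j' _ on) = not-Q {j'} on
    from-outside (at-v⁻ on j≡0) = Around.Entering.enter-detour-absurd (gadget i) p e on (D₁ j≡0)
    from-outside (at-v⁺ on j≡r+1) =
      Around.Entering.enter-detour-absurd (reversed (gadget i)) p e (trans on (cong (P-at i) (sym s+s∸suc[r]≡suc[s]))) (D₁ j≡r+1)

  all-P-absurd : (∀ n → Σ (Fin k) λ i → Σ (Fin K) λ j → C n ≡ inj₂ (inj₁ (i , j))) → ⊥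
  all-P-absurd on-P = no-cycle-along-paths P-at height located along
    where
    height : VX → ℕ
    height (inj₂ (inj₁ (_ , j))) = toℕ j
    height _ = 0
    located : ∀ q → Σ (Fin k) λ i → Σ ℕ λ j → C q ≡ P-at i j × height (P-at i j) ≡ j
    located q with on-P q
    ... | i , j , Cq = i , toℕ j , trans Cq (cong (λ z → inj₂ (inj₁ (i , z))) (sym (P-index-toℕ j))) , toℕ-P-index (toℕ≤2s j)
    not-P : ∀ n {v} → C n ≡ v → ¬ IsP v → ⊥
    not-P n Cn ¬P with on-P n
    ... | _ , _ , Cn' = ¬P (subst IsP (trans (sym Cn') Cn) tt)
    along : ∀ q n {i j} → C q ≡ P-at i j → height (P-at i j) ≡ j → EX (C q) (C n) →
            (C n ≡ P-at i (suc j) × height (P-at i (suc j)) ≡ suc j) ⊎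
            (Σ ℕ λ j' → j ≡ suc j' × C n ≡ P-at i j' × height (P-at i j') ≡ j')
    along q n {i} {j} Cq hj e = step (Pᵢ-nbrs i j (C n) j≤2s (subst (λ v → EX v (C n)) Cq e))
      where
      j≤2s : j ≤ s + s
      j≤2s = subst (_≤ s + s) hj (toℕ≤2s (P-index j))
      step : PNbr (P-at i) (I i ≡ true) (Q-at ∘ (i ,_)) (inj₁ (xm i)) (inj₁ (x i)) (inj₁ (xp i)) j (C n) → _
      step (next on j+1≤2s) = inj₁ (on , toℕ-P-index j+1≤2s)
      step (prev j' j≡1+j' back) = inj₂ (j' , j≡1+j' , back , toℕ-P-index (≤-trans (n≤1+n j') (subst (_≤ s + s) j≡1+j' j≤2s)))
      step (at-u⁻ on _) = ⊥-elim (not-P n on λ ())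
      step (at-u on _) = ⊥-elim (not-P n on λ ())
      step (at-u⁺ on _) = ⊥-elim (not-P n on λ ())
      step (at-Q₀ _ on _) = ⊥-elim (not-P n on λ ())
      step (at-Qₑ _ on _) = ⊥-elim (not-P n on λ ())

  all-Q-absurd : (∀ n → Σ Detour λ ie → Σ (Fin s) λ j → C n ≡ inj₂ (inj₂ (ie , j))) → ⊥
  all-Q-absurd on-Q = no-cycle-along-paths Q-at height located along
    where
    height : VX → ℕ
    height (inj₂ (inj₂ (_ , j))) = toℕ j
    height _ = 0
    located : ∀ q → Σ Detour λ ie → Σ ℕ λ j → C q ≡ Q-at ie j × height (Q-at ie j) ≡ j
    located q with on-Q q
    ... | ie , j , Cq = ie , toℕ j , trans Cq (cong (λ z → inj₂ (inj₂ (ie , z))) (sym (Q-index-toℕ j))) ,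
                        toℕ-Q-index (≤-pred (toℕ<n j))
    not-Q : ∀ n {v} → C n ≡ v → ¬ IsQ v → ⊥
    not-Q n Cn ¬Q with on-Q n
    ... | _ , _ , Cn' = ¬Q (subst IsQ (trans (sym Cn') Cn) tt)
    along : ∀ q n {ie j} → C q ≡ Q-at ie j → height (Q-at ie j) ≡ j → EX (C q) (C n) →
            (C n ≡ Q-at ie (suc j) × height (Q-at ie (suc j)) ≡ suc j) ⊎
            (Σ ℕ λ j' → j ≡ suc j' × C n ≡ Q-at ie j' × height (Q-at ie j') ≡ j')
    along q n {i , e} {j} Cq hj h = step (Qᵢ-nbrs i e j (C n) j≤r+1 (subst (λ v → EX v (C n)) Cq h))
      where
      j≤r+1 : j ≤ suc r
      j≤r+1 = subst (_≤ suc r) hj (≤-pred (toℕ<n (Q-index j)))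
      step : QNbr (P-at i) (Q-at (i , e)) j (C n) → _
      step (next on j+1≤r+1) = inj₁ (on , toℕ-Q-index j+1≤r+1)
      step (prev j' j≡1+j' back) = inj₂ (j' , j≡1+j' , back , toℕ-Q-index (≤-trans (n≤1+n j') (subst (_≤ suc r) j≡1+j' j≤r+1)))
      step (at-v⁻ on _) = ⊥-elim (not-Q n on λ ())
      step (at-v⁺ on _) = ⊥-elim (not-Q n on λ ())

  private
    on-P : ∀ v → ¬ ¬ IsP v → Σ (Fin k) λ i → Σ (Fin K) λ j → v ≡ inj₂ (inj₁ (i , j))
    on-P (inj₂ (inj₁ (i , j))) _ = i , j , refl
    on-P (inj₁ _) ¬¬P = ⊥-elim (¬¬P λ ())
    on-P (inj₂ (inj₂ _)) ¬¬P = ⊥-elim (¬¬P λ ())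

    on-Q : ∀ v → ¬ ¬ IsQ v → Σ Detour λ ie → Σ (Fin s) λ j → v ≡ inj₂ (inj₂ (ie , j))
    on-Q (inj₂ (inj₂ (ie , j))) _ = ie , j , refl
    on-Q (inj₁ _) ¬¬Q = ⊥-elim (¬¬Q λ ())
    on-Q (inj₂ (inj₁ _)) ¬¬Q = ⊥-elim (¬¬Q λ ())

    on-T : ∀ v → ¬ IsP v → ¬ IsQ v → Σ (TmV t m) λ a → v ≡ inj₁ a
    on-T (inj₁ a) _ _ = a , refl
    on-T (inj₂ (inj₁ _)) ¬P _ = ⊥-elim (¬P tt)
    on-T (inj₂ (inj₂ _)) _ ¬Q = ⊥-elim (¬Q tt)

  open InducedCycle cy using (vertex)

  avoiding-Q-absurd : (∀ n → ¬ IsQ (C n)) → ⊥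
  avoiding-Q-absurd noQ with any? (λ q → isP? (vertex q))
  ... | no noP = TowerCycleFree.no-cycle-in-tower r m
        (pullback cy inj₁ (λ _ _ → inner-edge) (λ _ _ → inj₁)
                  (λ q → proj₁ (on-T (vertex q) (noP ∘ (q ,_)) (noQ (toℕ q) ∘ subst IsQ (sym (C-toℕ q)))))
                  (λ q → proj₂ (on-T (vertex q) _ _)))
  ... | yes (q₀ , P₀) with any? (λ q → ¬? (isP? (vertex q)))
  ...   | yes (q₁ , ¬P₁) with entry-point IsP isP? q₀ q₁ P₀ ¬P₁
  ...     | p , ¬P , P = enter-P-absurd noQ p ¬P P
  avoiding-Q-absurd noQ | yes _ | no none = all-P-absurd λ n → on-P (C n) (none ∘ (idx n ,_))

  no-cycle-in-expansion : ⊥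
  no-cycle-in-expansion with any? (λ q → isQ? (vertex q))
  ... | no noQ = avoiding-Q-absurd λ n Qn → noQ (idx n , Qn)
  ... | yes (q₀ , Q₀) with any? (λ q → ¬? (isQ? (vertex q)))
  ...   | yes (q₁ , ¬Q₁) with entry-point IsQ isQ? q₀ q₁ Q₀ ¬Q₁
  ...     | p , ¬Q , Q = enter-Q-absurd p ¬Q Q
  no-cycle-in-expansion | yes _ | no none = all-Q-absurd λ n → on-Q (C n) (none ∘ (idx n ,_))

theorem3p2 : (t : ℕ) → 5 ≤ t → (Tr : Territory) → Canonical t Tr →
    CycleFree (2 * t ∸ 2) (T Tr)
theorem3p2 _ (s≤s (s≤s (s≤s (s≤s (s≤s (z≤n {r})))))) Tr (m , d , f , f-adj , _) (h , h-injective , h-adj) =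
  ExpansionCycle.no-cycle-in-expansion r m d
    (subst (InducedCycle (Expansion.EX r m d)) (2t∸2≡L r) (induced-cycle-image {G = T Tr} f f-adj h h-injective h-adj))
  where
  2t∸2≡L : ∀ r → 3 + (r + (5 + (r + 0))) ≡ 6 + (r + (2 + r))
  2t∸2≡L = solve-∀
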